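{- In the sequent calculus $\mathsf{S.ConstCKCEM}$, the rules $\mathsf{w_L}$: $\Gamma\Rightarrow\Delta$ / $\Gamma,\varphi\Rightarrow\Delta$; $\mathsf{w_R}$: $\Gamma\Rightarrow$ / $\Gamma\Rightarrow\varphi$; and $\mathsf{c}$: $\Gamma,\varphi,\varphi\Rightarrow\Delta$ / $\Gamma,\varphi\Rightarrow\Delta$ are height-preserving admissible, and $\mathsf{cut}$: $\Gamma\Rightarrow\varphi$, $\Gamma',\varphi\Rightarrow\Delta$ / $\Gamma,\Gamma'\Rightarrow\Delta$ is admissible. Moreover, for every sequent $\Gamma\Rightarrow\Delta$ over $\mathcal{L}$ with $|\Delta|\le1$, $\Gamma\Rightarrow\Delta$ is derivable in $\mathsf{S.ConstCKCEM}$ if and only if $\iota(\Gamma\Rightarrow\Delta)$ is derivable in $\mathsf{ConstCKCEM}$.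
   Context: $\mathcal{L}$: formulas $\varphi ::= p \mid \bot \mid \varphi\wedge\varphi \mid \varphi\vee\varphi \mid \varphi\to\varphi \mid \varphi \mathbin{\Box\!\!\rightarrow} \varphi \mid \varphi \mathbin{\Diamond\!\!\rightarrow}\varphi$; $\wedge,\vee$ bind more strongly than $\to,\mathbin{\Box\!\!\rightarrow},\mathbin{\Diamond\!\!\rightarrow}$; $\neg\varphi:=\varphi\to\bot$, $\top:=\neg\bot$, $\varphi\leftrightarrow\psi:=(\varphi\to\psi)\wedge(\psi\to\varphi)$. $\mathsf{ConstCKCEM}$: intuitionistic propositional logic in $\mathcal{L}$ with modus ponens, plus CM$_\Box$: $(\varphi\mathbin{\Box\!\!\rightarrow}\psi\wedge\chi)\to(\varphi\mathbin{\Box\!\!\rightarrow}\psi)\wedge(\varphi\mathbin{\Box\!\!\rightarrow}\chi)$; CC$_\Box$: $(\varphi\mathbin{\Box\!\!\rightarrow}\psi)\wedge(\varphi\mathbin{\Box\!\!\rightarrow}\chi)\to(\varphi\mathbin{\Box\!\!\rightarrow}\psi\wedge\chi)$; CN$_\Box$: $\varphi\mathbin{\Box\!\!\rightarrow}\top$; CN$_\Diamond$: $\neg(\varphi\mathbin{\Diamond\!\!\rightarrow}\bot)$; CK$_\Diamond$: $(\varphi\mathbin{\Box\!\!\rightarrow}(\psi\to\chi))\to((\varphi\mathbin{\Diamond\!\!\rightarrow}\psi)\to(\varphi\mathbin{\Diamond\!\!\rightarrow}\chi))$; CEM$_\Diamond$: $(\varphi\mathbin{\Diamond\!\!\rightarrow}\psi)\wedge(\varphi\mathbin{\Diamond\!\!\rightarrow}\chi)\to(\varphi\mathbin{\Diamond\!\!\rightarrow}\psi\wedge\chi)$;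 and rules RA$_\Box$: from $\varphi\leftrightarrow\rho$ infer $(\varphi\mathbin{\Box\!\!\rightarrow}\psi)\leftrightarrow(\rho\mathbin{\Box\!\!\rightarrow}\psi)$; RC$_\Box$: from $\psi\leftrightarrow\chi$ infer $(\varphi\mathbin{\Box\!\!\rightarrow}\psi)\leftrightarrow(\varphi\mathbin{\Box\!\!\rightarrow}\chi)$; RA$_\Diamond$, RC$_\Diamond$ likewise with $\mathbin{\Diamond\!\!\rightarrow}$. Sequents: finite multisets, $|\Delta|\le1$; $\iota(\Gamma\Rightarrow\Delta)=\bigwedge\Gamma\to\bigvee\Delta$ if $\Gamma\ne\emptyset$, $\bigvee\Delta$ otherwise, $\bigvee\emptyset=\bot$. $\varphi\Leftrightarrow\rho$ abbreviates the sequents $\varphi\Rightarrow\rho$, $\rho\Rightarrow\varphi$. $\mathsf{S.ConstCKCEM}$ rules ($|\Delta|\le1$, $n,k\ge0$): init: $\Gamma,p\Rightarrow p$; $\bot_L$: $\Gamma,\bot\Rightarrow\Delta$; $\wedge_L$: $\Gamma,\varphi,\psi\Rightarrow\Delta$ / $\Gamma,\varphi\wedge\psi\Rightarrow\Delta$; $\wedge_R$: $\Gamma\Rightarrow\varphi$, $\Gamma\Rightarrow\psi$ / $\Gamma\Rightarrow\varphi\wedge\psi$; $\vee_L$: $\Gamma,\varphi\Rightarrow\Delta$, $\Gamma,\psi\Rightarrow\Delta$ / $\Gamma,\varphi\vee\psi\Rightarrow\Delta$; $\vee_R^{1}$: $\Gamma\Rightarrow\varphi$ / $\Gamma\Rightarrow\varphi\vee\psi$;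 $\vee_R^{2}$: $\Gamma\Rightarrow\psi$ / $\Gamma\Rightarrow\varphi\vee\psi$; $\to_R$: $\Gamma,\varphi\Rightarrow\psi$ / $\Gamma\Rightarrow\varphi\to\psi$; $\to_L$: $\Gamma,\varphi\to\psi\Rightarrow\varphi$, $\Gamma,\psi\Rightarrow\Delta$ / $\Gamma,\varphi\to\psi\Rightarrow\Delta$; $\Box$: $\{\varphi\Leftrightarrow\rho_i\}_{i\le n}$, $\sigma_1,\dots,\sigma_n\Rightarrow\psi$ / $\Gamma,\rho_1\mathbin{\Box\!\!\rightarrow}\sigma_1,\dots,\rho_n\mathbin{\Box\!\!\rightarrow}\sigma_n\Rightarrow\varphi\mathbin{\Box\!\!\rightarrow}\psi$; $\Diamond^{cem}$: $\{\varphi\Leftrightarrow\rho_i\}_{i\le n}$, $\{\varphi\Leftrightarrow\xi_j\}_{j\le k}$, $\varphi\Leftrightarrow\eta$, $\sigma_1,\dots,\sigma_n,\chi_1,\dots,\chi_k,\psi\Rightarrow\vartheta$ / $\Gamma,\rho_1\mathbin{\Box\!\!\rightarrow}\sigma_1,\dots,\rho_n\mathbin{\Box\!\!\rightarrow}\sigma_n,\xi_1\mathbin{\Diamond\!\!\rightarrow}\chi_1,\dots,\xi_k\mathbin{\Diamond\!\!\rightarrow}\chi_k,\varphi\mathbin{\Diamond\!\!\rightarrow}\psi\Rightarrow\eta\mathbin{\Diamond\!\!\rightarrow}\vartheta$; $\Box\Diamond^{cem}$: $\{\varphi\Leftrightarrow\rho_i\}_{i\le n}$, $\{\varphi\Leftrightarrow\xi_j\}_{j\le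 k}$, $\sigma_1,\dots,\sigma_n,\chi_1,\dots,\chi_k,\psi\Rightarrow$ / $\Gamma,\rho_1\mathbin{\Box\!\!\rightarrow}\sigma_1,\dots,\rho_n\mathbin{\Box\!\!\rightarrow}\sigma_n,\xi_1\mathbin{\Diamond\!\!\rightarrow}\chi_1,\dots,\xi_k\mathbin{\Diamond\!\!\rightarrow}\chi_k,\varphi\mathbin{\Diamond\!\!\rightarrow}\psi\Rightarrow\Delta$. Height of a derivation: length of longest branch minus 1; height-preserving admissible: premiss derivable with height $\le h$ implies conclusion derivable with height $\le h$. -}

module Defs where

open import Data.Nat using (ℕ; suc)
open import Data.List using (List; []; _∷_; _++_; map; [_])
open import Data.List.Relation.Unary.All using (All)
open import Data.List.Relation.Binary.Permutation.Propositional using (_↭_)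
open import Data.Maybe using (Maybe; just; nothing)
open import Data.Product using (_×_; _,_; proj₁; proj₂; ∃)

infixr 6 _∧̇_ _∨̇_
infixr 5 _⊃_ _□→_ _◇→_

data Fm : Set where
  var  : ℕ → Fm
  ⊥̇    : Fm
  _∧̇_  : Fm → Fm → Fm
  _∨̇_  : Fm → Fm → Fm
  _⊃_  : Fm → Fm → Fm
  _□→_ : Fm → Fm → Fm
  _◇→_ : Fm → Fm → Fm

¬̇_ : Fm → Fm
¬̇ φ = φ ⊃ ⊥̇

⊤̇ : Fm
⊤̇ = ¬̇ ⊥̇

_⇔̇_ : Fm → Fm → Fm
φ ⇔̇ ψ = (φ ⊃ ψ) ∧̇ (ψ ⊃ φ)

-- Hilbert system ConstCKCEM.  IPC is given by a standard complete
-- Hilbert axiomatisation (schemes instantiated by arbitrary L-formulas)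
-- with modus ponens.

data ⊢H : Fm → Set where
  ax-K    : ∀ φ ψ → ⊢H (φ ⊃ ψ ⊃ φ)
  ax-S    : ∀ φ ψ χ → ⊢H ((φ ⊃ ψ ⊃ χ) ⊃ (φ ⊃ ψ) ⊃ φ ⊃ χ)
  ax-∧E₁  : ∀ φ ψ → ⊢H (φ ∧̇ ψ ⊃ φ)
  ax-∧E₂  : ∀ φ ψ → ⊢H (φ ∧̇ ψ ⊃ ψ)
  ax-∧I   : ∀ φ ψ → ⊢H (φ ⊃ ψ ⊃ φ ∧̇ ψ)
  ax-∨I₁  : ∀ φ ψ → ⊢H (φ ⊃ φ ∨̇ ψ)
  ax-∨I₂  : ∀ φ ψ → ⊢H (ψ ⊃ φ ∨̇ ψ)
  ax-∨E   : ∀ φ ψ χ → ⊢H ((φ ⊃ χ) ⊃ (ψ ⊃ χ) ⊃ (φ ∨̇ ψ ⊃ χ))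
  ax-EFQ  : ∀ φ → ⊢H (⊥̇ ⊃ φ)
  mp      : ∀ {φ ψ} → ⊢H (φ ⊃ ψ) → ⊢H φ → ⊢H ψ
  CM□     : ∀ φ ψ χ → ⊢H ((φ □→ ψ ∧̇ χ) ⊃ (φ □→ ψ) ∧̇ (φ □→ χ))
  CC□     : ∀ φ ψ χ → ⊢H ((φ □→ ψ) ∧̇ (φ □→ χ) ⊃ (φ □→ ψ ∧̇ χ))
  CN□     : ∀ φ → ⊢H (φ □→ ⊤̇)
  CN◇     : ∀ φ → ⊢H (¬̇ (φ ◇→ ⊥̇))
  CK◇     : ∀ φ ψ χ → ⊢H ((φ □→ (ψ ⊃ χ)) ⊃ ((φ ◇→ ψ) ⊃ (φ ◇→ χ)))
  CEM◇    : ∀ φ ψ χ → ⊢H ((φ ◇→ ψ) ∧̇ (φ ◇→ χ) ⊃ (φ ◇→ ψ ∧̇ χ))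
  RA□     : ∀ {φ ρ} ψ → ⊢H (φ ⇔̇ ρ) → ⊢H ((φ □→ ψ) ⇔̇ (ρ □→ ψ))
  RC□     : ∀ φ {ψ χ} → ⊢H (ψ ⇔̇ χ) → ⊢H ((φ □→ ψ) ⇔̇ (φ □→ χ))
  RA◇     : ∀ {φ ρ} ψ → ⊢H (φ ⇔̇ ρ) → ⊢H ((φ ◇→ ψ) ⇔̇ (ρ ◇→ ψ))
  RC◇     : ∀ φ {ψ χ} → ⊢H (ψ ⇔̇ χ) → ⊢H ((φ ◇→ ψ) ⇔̇ (φ ◇→ χ))

-- Formula interpretation of sequents Γ ⇒ Δ, with |Δ| ≤ 1 encoded as Maybe Fm.

⋀ : Fm → List Fm → Fm
⋀ φ []      = φ
⋀ φ (ψ ∷ Γ) = φ ∧̇ ⋀ ψ Γ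

⋁ : Maybe Fm → Fm
⋁ nothing  = ⊥̇
⋁ (just φ) = φ

ι : List Fm → Maybe Fm → Fm
ι []      Δ = ⋁ Δ
ι (φ ∷ Γ) Δ = ⋀ φ Γ ⊃ ⋁ Δ

-- Antecedents are multisets, represented as lists; each rule's conclusion
-- antecedent Γ is accepted up to permutation (Γ ↭ pattern).
-- D h Γ Δ : "Γ ⇒ Δ has a derivation of height ≤ h"
-- (initial sequents at every h; a rule with premisses at height ≤ h
-- gives its conclusion at height ≤ suc h).

boxes : List (Fm × Fm) → List Fm
boxes = map (λ b → proj₁ b □→ proj₂ b)

dias : List (Fm × Fm) → List Fm
dias = map (λ b → proj₁ b ◇→ proj₂ b)

data D : ℕ → List Fm → Maybe Fm → Set where
  init : ∀ {h Γ Γ₀ p} → Γ ↭ var p ∷ Γ₀ → D h Γ (just (var p))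
  ⊥L   : ∀ {h Γ Γ₀ Δ} → Γ ↭ ⊥̇ ∷ Γ₀ → D h Γ Δ
  ∧L   : ∀ {h Γ Γ₀ Δ φ ψ} → Γ ↭ (φ ∧̇ ψ) ∷ Γ₀ →
         D h (φ ∷ ψ ∷ Γ₀) Δ → D (suc h) Γ Δ
  ∧R   : ∀ {h Γ φ ψ} → D h Γ (just φ) → D h Γ (just ψ) →
         D (suc h) Γ (just (φ ∧̇ ψ))
  ∨L   : ∀ {h Γ Γ₀ Δ φ ψ} → Γ ↭ (φ ∨̇ ψ) ∷ Γ₀ →
         D h (φ ∷ Γ₀) Δ → D h (ψ ∷ Γ₀) Δ → D (suc h) Γ Δ
  ∨R₁  : ∀ {h Γ φ ψ} → D h Γ (just φ) → D (suc h) Γ (just (φ ∨̇ ψ))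
  ∨R₂  : ∀ {h Γ φ ψ} → D h Γ (just ψ) → D (suc h) Γ (just (φ ∨̇ ψ))
  ⊃R   : ∀ {h Γ φ ψ} → D h (φ ∷ Γ) (just ψ) → D (suc h) Γ (just (φ ⊃ ψ))
  ⊃L   : ∀ {h Γ Γ₀ Δ φ ψ} → Γ ↭ (φ ⊃ ψ) ∷ Γ₀ →
         D h ((φ ⊃ ψ) ∷ Γ₀) (just φ) → D h (ψ ∷ Γ₀) Δ → D (suc h) Γ Δ
  □R   : ∀ {h Γ Γ₀ φ ψ} (bs : List (Fm × Fm)) →
         Γ ↭ Γ₀ ++ boxes bs →
         All (λ b → D h [ φ ] (just (proj₁ b))) bs →
         All (λ b → D h [ proj₁ b ] (just φ)) bs →
         D h (map proj₂ bs) (just ψ) →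
         D (suc h) Γ (just (φ □→ ψ))
  ◇cem : ∀ {h Γ Γ₀ φ ψ η ϑ} (bs ds : List (Fm × Fm)) →
         Γ ↭ Γ₀ ++ boxes bs ++ dias ds ++ [ φ ◇→ ψ ] →
         All (λ b → D h [ φ ] (just (proj₁ b))) bs →
         All (λ b → D h [ proj₁ b ] (just φ)) bs →
         All (λ b → D h [ φ ] (just (proj₁ b))) ds →
         All (λ b → D h [ proj₁ b ] (just φ)) ds →
         D h [ φ ] (just η) → D h [ η ] (just φ) →
         D h (map proj₂ bs ++ map proj₂ ds ++ [ ψ ]) (just ϑ) →
         D (suc h) Γ (just (η ◇→ ϑ))
  □◇cem : ∀ {h Γ Γ₀ Δ φ ψ} (bs ds : List (Fm × Fm)) →
         Γ ↭ Γ₀ ++ boxes bs ++ dias ds ++ [ φ ◇→ ψ ] →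
         All (λ b → D h [ φ ] (just (proj₁ b))) bs →
         All (λ b → D h [ proj₁ b ] (just φ)) bs →
         All (λ b → D h [ φ ] (just (proj₁ b))) ds →
         All (λ b → D h [ proj₁ b ] (just φ)) ds →
         D h (map proj₂ bs ++ map proj₂ ds ++ [ ψ ]) nothing →
         D (suc h) Γ Δ

Derivable : List Fm → Maybe Fm → Set
Derivable Γ Δ = ∃ λ h → D h Γ Δ

-- Weakening and contraction are height-preserving by induction on derivations; contraction also needs
-- the height-preserving invertibility of the propositional left rules, and for the modal rules one of two
-- copies of a boxed or diamond formula is dropped from the modal block together with one copy of its side
-- formula in the premiss.
--
-- Cut is eliminated by induction on a bound n for the sizes of all formulas of the cut, then on the cut
-- formula, then on the heights of the premisses. A cut whose formula is not principal in both premisses is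
-- permuted upwards; a propositional principal cut becomes cuts on immediate subformulas followed by
-- contraction; two principal modal rules are merged into a single modal rule. The main premisses of the
-- two rules are joined by a cut on the consequent of the cut formula, and the premisses φ ⇔ ρ of the merged
-- rule are chained through the antecedents of both rules by cuts of size below n. Those antecedents are in
-- general not subformulas of the cut formula, which is why the bound covers every formula of the cut.
--
-- Soundness reads a □-rule as CN□, CC□ and RA□ collecting the boxed side formulas into one conjunction,
-- and a ◇-rule as, in addition, CEM◇ and RA◇ collecting the diamonds and CK◇ discharging the premiss;
-- completeness derives every axiom and rule of ConstCKCEM, modus ponens by cut.

module Submission where

open import Defs
open import Data.List using (List; []; _∷_; _++_; map; [_])
open import Data.Maybe as Maybe using (Maybe; just; nothing)
open import Data.Product using (_×_; _,_; proj₁; proj₂; ∃; -,_)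
open import Data.Sum using (_⊎_; inj₁; inj₂)
open import Function.Bundles using (_⇔_; mk⇔)
open import Data.Nat using (ℕ; zero; suc; _⊔_; _≤_; s≤s; _+_)
open import Data.Nat.Properties using (≤-trans; n≤1+n; m≤m⊔n; m≤n⊔m; m≤m+n; m≤n+m)
open import Data.Empty using (⊥; ⊥-elim)
open import Relation.Binary.PropositionalEquality as ≡ using (_≡_; refl; subst)
open import Data.Unit using (⊤; tt)
open import Data.List.Relation.Unary.All as All using (All; []; _∷_)
import Data.List.Relation.Unary.All.Properties as Allₚ
open import Data.List.Properties using (map-++; ++-identityʳ; ∷-injectiveʳ)
open import Data.List.Relation.Unary.Any using (here; there)
open import Data.List.Membership.Propositional using (_∈_)
open import Data.List.Membership.Propositional.Properties using (∈-∃++; ∈-++⁻; ∈-map⁻)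
open import Data.List.Relation.Binary.Permutation.Propositional
  using (_↭_; prep; swap; ↭-refl; ↭-sym; ↭-trans; ↭-reflexive)
open import Data.List.Relation.Binary.Permutation.Propositional.Properties
  using (∈-resp-↭; All-resp-↭; ↭-singleton-inv; drop-∷; shift; ++⁺; ++⁺ʳ; ++⁺ˡ; ++-comm; ++-assoc;
         map⁺; ↭-map-inv; ++-commutativeMonoid)
open import Algebra.Solver.CommutativeMonoid (++-commutativeMonoid {A = Fm})
  using (solve; _⊜_; _⊕_)

private variable
  h h′ : ℕ
  x y φ ψ A B : Fm
  Γ Γ′ Γ₀ Γ₁ L : List Fm
  Δ : Maybe Fm
  bs ds : List (Fm × Fm)

-- Multisets as lists up to permutation

∈⇒↭ : ∀ {a} {X : Set a} {x : X} {xs} → x ∈ xs → ∃ λ ys → xs ↭ x ∷ ys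
∈⇒↭ x∈xs with ys , zs , refl ← ∈-∃++ x∈xs = ys ++ zs , shift _ ys zs

↭⇒∈ : Γ ↭ x ∷ Γ₀ → x ∈ Γ
↭⇒∈ π = ∈-resp-↭ (↭-sym π) (here refl)

swap-head : x ∷ y ∷ Γ ↭ y ∷ x ∷ Γ
swap-head = swap _ _ ↭-refl

sink₂ : x ∷ A ∷ B ∷ Γ ↭ A ∷ B ∷ x ∷ Γ
sink₂ = ↭-trans swap-head (prep _ swap-head)

shift₂ : ∀ Γ₀ → Γ₀ ++ A ∷ B ∷ Γ ↭ A ∷ B ∷ Γ₀ ++ Γ
shift₂ Γ₀ = ↭-trans (shift _ Γ₀ _) (prep _ (shift _ Γ₀ _))

cons-focus : Γ ↭ x ∷ Γ₀ → y ∷ Γ ↭ x ∷ y ∷ Γ₀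
cons-focus π = ↭-trans (prep _ π) swap-head

prefix-focus : ∀ L → Γ ↭ x ∷ Γ₀ → L ++ Γ ↭ x ∷ L ++ Γ₀
prefix-focus L π = ↭-trans (++⁺ˡ L π) (shift _ L _)

head-split : x ∷ Γ ↭ y ∷ Γ₀ →
  (x ≡ y × Γ ↭ Γ₀) ⊎ (∃ λ Γ₁ → Γ₀ ↭ x ∷ Γ₁ × Γ ↭ y ∷ Γ₁)
head-split π with ∈-resp-↭ π (here refl)
... | here refl = inj₁ (refl , drop-∷ π)
... | there x∈ with Γ₁ , p ← ∈⇒↭ x∈ =
  inj₂ (Γ₁ , p , drop-∷ (↭-trans π (cons-focus p)))

++-split : ∀ Γ₀ {M} → x ∷ Γ ↭ Γ₀ ++ M →
  (∃ λ Γ₁ → Γ₀ ↭ x ∷ Γ₁ × Γ ↭ Γ₁ ++ M) ⊎ (∃ λ M′ → M ↭ x ∷ M′ × Γ ↭ Γ₀ ++ M′)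
++-split Γ₀ {M} π with ∈-++⁻ Γ₀ (∈-resp-↭ π (here refl))
... | inj₁ x∈ with Γ₁ , p ← ∈⇒↭ x∈ = inj₁ (Γ₁ , p , drop-∷ (↭-trans π (++⁺ʳ M p)))
... | inj₂ x∈ with M′ , p ← ∈⇒↭ x∈ =
  inj₂ (M′ , p , drop-∷ (↭-trans π (↭-trans (++⁺ˡ Γ₀ p) (shift _ Γ₀ M′))))

head₂-split : x ∷ x ∷ Γ ↭ y ∷ Γ₀ →
  (x ≡ y × Γ₀ ↭ x ∷ Γ) ⊎ (∃ λ Γ₁ → Γ₀ ↭ x ∷ x ∷ Γ₁ × Γ ↭ y ∷ Γ₁)
head₂-split π with head-split π
... | inj₁ (eq , q) = inj₁ (eq , ↭-sym q)
... | inj₂ (Γ₁ , p , q) with head-split q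
...   | inj₁ (eq , r) = inj₁ (eq , ↭-trans p (prep _ (↭-sym r)))
...   | inj₂ (Γ₂ , p′ , q′) = inj₂ (Γ₂ , ↭-trans p (prep _ p′) , q′)

++-split₂ : ∀ Γ₀ {M} → x ∷ x ∷ Γ ↭ Γ₀ ++ M →
  (∃ λ Γ₁ → x ∷ Γ ↭ Γ₁ ++ M) ⊎ (∃ λ M′ → M ↭ x ∷ x ∷ M′ × Γ ↭ Γ₀ ++ M′)
++-split₂ Γ₀ {M} π with ++-split Γ₀ π
... | inj₁ (Γ₁ , _ , q) = inj₁ (Γ₁ , q)
... | inj₂ (M′ , p , q) with ++-split Γ₀ q
...   | inj₁ (Γ₁ , _ , q′) =
  inj₁ (Γ₁ , ↭-trans (prep _ q′) (↭-trans (↭-sym (shift _ Γ₁ _)) (++⁺ˡ Γ₁ (↭-sym p))))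
...   | inj₂ (M″ , p′ , q′) = inj₂ (M″ , ↭-trans p (prep _ p′) , q′)

-- Height-preserving structural rules

raise : h ≤ h′ → D h Γ Δ → D h′ Γ Δ
raise-All : ∀ {F : Fm × Fm → List Fm} {G : Fm × Fm → Maybe Fm} {bs} → h ≤ h′ →
  All (λ b → D h (F b) (G b)) bs → All (λ b → D h′ (F b) (G b)) bs
raise-All le [] = []
raise-All le (d ∷ ds) = raise le d ∷ raise-All le ds
raise le (init π) = init π
raise le (⊥L π) = ⊥L π
raise (s≤s le) (∧L π d) = ∧L π (raise le d)
raise (s≤s le) (∧R d e) = ∧R (raise le d) (raise le e)
raise (s≤s le) (∨L π d e) = ∨L π (raise le d) (raise le e)
raise (s≤s le) (∨R₁ d) = ∨R₁ (raise le d)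
raise (s≤s le) (∨R₂ d) = ∨R₂ (raise le d)
raise (s≤s le) (⊃R d) = ⊃R (raise le d)
raise (s≤s le) (⊃L π d e) = ⊃L π (raise le d) (raise le e)
raise (s≤s le) (□R {Γ₀ = Γ₀} bs π l r c) =
  □R {Γ₀ = Γ₀} bs π (raise-All le l) (raise-All le r) (raise le c)
raise (s≤s le) (◇cem {Γ₀ = Γ₀} bs ds π lb rb ld rd e f g) =
  ◇cem {Γ₀ = Γ₀} bs ds π (raise-All le lb) (raise-All le rb) (raise-All le ld) (raise-All le rd)
    (raise le e) (raise le f) (raise le g)
raise (s≤s le) (□◇cem {Γ₀ = Γ₀} bs ds π lb rb ld rd g) =
  □◇cem {Γ₀ = Γ₀} bs ds π (raise-All le lb) (raise-All le rb) (raise-All le ld) (raise-All le rd)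
    (raise le g)

exchange : Γ ↭ Γ′ → D h Γ Δ → D h Γ′ Δ
exchange σ (init π) = init (↭-trans (↭-sym σ) π)
exchange σ (⊥L π) = ⊥L (↭-trans (↭-sym σ) π)
exchange σ (∧L π d) = ∧L (↭-trans (↭-sym σ) π) d
exchange σ (∧R d e) = ∧R (exchange σ d) (exchange σ e)
exchange σ (∨L π d e) = ∨L (↭-trans (↭-sym σ) π) d e
exchange σ (∨R₁ d) = ∨R₁ (exchange σ d)
exchange σ (∨R₂ d) = ∨R₂ (exchange σ d)
exchange σ (⊃R d) = ⊃R (exchange (prep _ σ) d)
exchange σ (⊃L π d e) = ⊃L (↭-trans (↭-sym σ) π) d e
exchange σ (□R {Γ₀ = Γ₀} bs π l r c) = □R {Γ₀ = Γ₀} bs (↭-trans (↭-sym σ) π) l r c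
exchange σ (◇cem {Γ₀ = Γ₀} bs ds π lb rb ld rd e f g) =
  ◇cem {Γ₀ = Γ₀} bs ds (↭-trans (↭-sym σ) π) lb rb ld rd e f g
exchange σ (□◇cem {Γ₀ = Γ₀} bs ds π lb rb ld rd g) =
  □◇cem {Γ₀ = Γ₀} bs ds (↭-trans (↭-sym σ) π) lb rb ld rd g

weakenL : ∀ φ → D h Γ Δ → D h (φ ∷ Γ) Δ
weakenL φ (init π) = init (cons-focus π)
weakenL φ (⊥L π) = ⊥L (cons-focus π)
weakenL φ (∧L π d) = ∧L (cons-focus π) (exchange sink₂ (weakenL φ d))
weakenL φ (∧R d e) = ∧R (weakenL φ d) (weakenL φ e)
weakenL φ (∨L π d e) = ∨L (cons-focus π) (exchange swap-head (weakenL φ d)) (exchange swap-head (weakenL φ e))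
weakenL φ (∨R₁ d) = ∨R₁ (weakenL φ d)
weakenL φ (∨R₂ d) = ∨R₂ (weakenL φ d)
weakenL φ (⊃R d) = ⊃R (exchange swap-head (weakenL φ d))
weakenL φ (⊃L π d e) = ⊃L (cons-focus π) (exchange swap-head (weakenL φ d)) (exchange swap-head (weakenL φ e))
weakenL φ (□R {Γ₀ = Γ₀} bs π l r c) = □R {Γ₀ = φ ∷ Γ₀} bs (prep φ π) l r c
weakenL φ (◇cem {Γ₀ = Γ₀} bs ds π lb rb ld rd e f g) =
  ◇cem {Γ₀ = φ ∷ Γ₀} bs ds (prep φ π) lb rb ld rd e f g
weakenL φ (□◇cem {Γ₀ = Γ₀} bs ds π lb rb ld rd g) =
  □◇cem {Γ₀ = φ ∷ Γ₀} bs ds (prep φ π) lb rb ld rd g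

weakenR : ∀ φ → D h Γ nothing → D h Γ (just φ)
weakenR φ (⊥L π) = ⊥L π
weakenR φ (∧L π d) = ∧L π (weakenR φ d)
weakenR φ (∨L π d e) = ∨L π (weakenR φ d) (weakenR φ e)
weakenR φ (⊃L π d e) = ⊃L π d (weakenR φ e)
weakenR φ (□◇cem {Γ₀ = Γ₀} bs ds π lb rb ld rd g) = □◇cem {Γ₀ = Γ₀} bs ds π lb rb ld rd g

weakenL-++ : ∀ L → D h Γ Δ → D h (L ++ Γ) Δ
weakenL-++ [] d = d
weakenL-++ (φ ∷ L) d = weakenL φ (weakenL-++ L d)

weakenL-++ʳ : ∀ L → D h Γ Δ → D h (Γ ++ L) Δ
weakenL-++ʳ {Γ = Γ} L d = exchange (++-comm L Γ) (weakenL-++ L d)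

-- Inversion and contraction

data Modal : Fm → Set where
  □→-modal : Modal (A □→ B)
  ◇→-modal : Modal (A ◇→ B)

data Compound : Fm → Set where
  ∧-compound : Compound (A ∧̇ B)
  ∨-compound : Compound (A ∨̇ B)
  ⊃-compound : Compound (A ⊃ B)

boxes-modal : ∀ bs → All Modal (boxes bs)
boxes-modal [] = []
boxes-modal (_ ∷ bs) = □→-modal ∷ boxes-modal bs

dias-modal : ∀ ds → All Modal (dias ds)
dias-modal [] = []
dias-modal (_ ∷ ds) = ◇→-modal ∷ dias-modal ds

◇-block-modal : ∀ bs ds φ ψ → All Modal (boxes bs ++ dias ds ++ [ φ ◇→ ψ ])
◇-block-modal bs ds φ ψ = Allₚ.++⁺ (boxes-modal bs) (Allₚ.++⁺ (dias-modal ds) (◇→-modal ∷ []))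

compound-in-context : ∀ Γ₀ {M} → Compound x → All Modal M → x ∷ Γ ↭ Γ₀ ++ M →
  ∃ λ Γ₁ → Γ₀ ↭ x ∷ Γ₁ × Γ ↭ Γ₁ ++ M
compound-in-context Γ₀ cx modal π with ++-split Γ₀ π
... | inj₁ r = r
... | inj₂ (_ , p , _) with All.lookup modal (↭⇒∈ p) | cx
...   | □→-modal | ()
...   | ◇→-modal | ()

-- Replacing a compound x on the left by Ys is height-preserving as soon as it is so
-- for the derivations whose last rule has x principal.
module Inversion (x : Fm) (cx : Compound x) (Ys : List Fm)
  (on-∧L : ∀ {h Γ₀ Δ A B} → x ≡ A ∧̇ B → D h (A ∷ B ∷ Γ₀) Δ → D (suc h) (Ys ++ Γ₀) Δ)
  (on-∨L : ∀ {h Γ₀ Δ A B} → x ≡ A ∨̇ B → D h (A ∷ Γ₀) Δ → D h (B ∷ Γ₀) Δ → D (suc h) (Ys ++ Γ₀) Δ)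
  (on-⊃L : ∀ {h Γ₀ Δ A B} → x ≡ A ⊃ B → D h ((A ⊃ B) ∷ Γ₀) (just A) → D h (B ∷ Γ₀) Δ →
           D (suc h) (Ys ++ Γ₀) Δ)
  where

  private
    into : Γ₀ ↭ x ∷ Γ₁ → D h (A ∷ Γ₀) Δ → D h (x ∷ A ∷ Γ₁) Δ
    into p = exchange (↭-trans (prep _ p) swap-head)

    out : D h (Ys ++ A ∷ Γ₁) Δ → D h (A ∷ Ys ++ Γ₁) Δ
    out = exchange (shift _ Ys _)

    modal-context : ∀ Γ₀ {M} → All Modal M → x ∷ Γ ↭ Γ₀ ++ M → ∃ λ Γ₁ → Ys ++ Γ ↭ (Ys ++ Γ₁) ++ M
    modal-context Γ₀ modal π with Γ₁ , _ , q ← compound-in-context Γ₀ cx modal π =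
      Γ₁ , ↭-trans (++⁺ˡ Ys q) (↭-sym (++-assoc Ys Γ₁ _))

    not-atomic : ∀ {p} → x ≡ var p → ⊥
    not-atomic eq with subst Compound eq cx
    ... | ()

    not-⊥ : x ≡ ⊥̇ → ⊥
    not-⊥ eq with subst Compound eq cx
    ... | ()

  invert : D h (x ∷ Γ) Δ → D h (Ys ++ Γ) Δ
  invert (init π) with head-split π
  ... | inj₁ (eq , _) = ⊥-elim (not-atomic eq)
  ... | inj₂ (_ , _ , q) = init (prefix-focus Ys q)
  invert (⊥L π) with head-split π
  ... | inj₁ (eq , _) = ⊥-elim (not-⊥ eq)
  ... | inj₂ (_ , _ , q) = ⊥L (prefix-focus Ys q)
  invert (∧L π d) with head-split π
  ... | inj₁ (eq , q) = exchange (++⁺ˡ Ys (↭-sym q)) (on-∧L eq d)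
  ... | inj₂ (_ , p , q) =
    ∧L (prefix-focus Ys q) (exchange (shift₂ Ys) (invert (exchange (↭-trans (prep _ (prep _ p)) (↭-sym sink₂)) d)))
  invert (∧R d e) = ∧R (invert d) (invert e)
  invert (∨L π d e) with head-split π
  ... | inj₁ (eq , q) = exchange (++⁺ˡ Ys (↭-sym q)) (on-∨L eq d e)
  ... | inj₂ (_ , p , q) = ∨L (prefix-focus Ys q) (out (invert (into p d))) (out (invert (into p e)))
  invert (∨R₁ d) = ∨R₁ (invert d)
  invert (∨R₂ d) = ∨R₂ (invert d)
  invert (⊃R d) = ⊃R (out (invert (exchange swap-head d)))
  invert (⊃L π d e) with head-split π
  ... | inj₁ (eq , q) = exchange (++⁺ˡ Ys (↭-sym q)) (on-⊃L eq d e)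
  ... | inj₂ (_ , p , q) = ⊃L (prefix-focus Ys q) (out (invert (into p d))) (out (invert (into p e)))
  invert (□R {Γ₀ = Γ₀} bs π l r c) with Γ₁ , q ← modal-context Γ₀ (boxes-modal bs) π =
    □R {Γ₀ = Ys ++ Γ₁} bs q l r c
  invert (◇cem {Γ₀ = Γ₀} {φ = φ} {ψ = ψ} bs ds π lb rb ld rd e f g)
    with Γ₁ , q ← modal-context Γ₀ (◇-block-modal bs ds φ ψ) π =
    ◇cem {Γ₀ = Ys ++ Γ₁} bs ds q lb rb ld rd e f g
  invert (□◇cem {Γ₀ = Γ₀} {φ = φ} {ψ = ψ} bs ds π lb rb ld rd g)
    with Γ₁ , q ← modal-context Γ₀ (◇-block-modal bs ds φ ψ) π =
    □◇cem {Γ₀ = Ys ++ Γ₁} bs ds q lb rb ld rd g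

step : D h Γ Δ → D (suc h) Γ Δ
step = raise (n≤1+n _)

∧L-inv : ∀ A B → D h ((A ∧̇ B) ∷ Γ) Δ → D h (A ∷ B ∷ Γ) Δ
∧L-inv A B = Inversion.invert (A ∧̇ B) ∧-compound (A ∷ B ∷ [])
  (λ { refl d → step d }) (λ { () }) (λ { () })

∨L-inv₁ : ∀ A B → D h ((A ∨̇ B) ∷ Γ) Δ → D h (A ∷ Γ) Δ
∨L-inv₁ A B = Inversion.invert (A ∨̇ B) ∨-compound (A ∷ [])
  (λ { () }) (λ { refl d _ → step d }) (λ { () })

∨L-inv₂ : ∀ A B → D h ((A ∨̇ B) ∷ Γ) Δ → D h (B ∷ Γ) Δ
∨L-inv₂ A B = Inversion.invert (A ∨̇ B) ∨-compound (B ∷ [])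
  (λ { () }) (λ { refl _ e → step e }) (λ { () })

⊃L-inv : ∀ A B → D h ((A ⊃ B) ∷ Γ) Δ → D h (B ∷ Γ) Δ
⊃L-inv A B = Inversion.invert (A ⊃ B) ⊃-compound (B ∷ [])
  (λ { () }) (λ { () }) (λ { refl _ e → step e })

data Occurrence (bs ds : List (Fm × Fm)) (R : List Fm) (x : Fm) : Set where
  in-boxes : ∀ ρ σ bs′ → bs ↭ (ρ , σ) ∷ bs′ → x ≡ (ρ □→ σ) →
    boxes bs ++ dias ds ++ R ↭ x ∷ boxes bs′ ++ dias ds ++ R → Occurrence bs ds R x
  in-dias : ∀ ρ σ ds′ → ds ↭ (ρ , σ) ∷ ds′ → x ≡ (ρ ◇→ σ) →
    boxes bs ++ dias ds ++ R ↭ x ∷ boxes bs ++ dias ds′ ++ R → Occurrence bs ds R x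
  in-rest : ∀ R′ → R ↭ x ∷ R′ →
    boxes bs ++ dias ds ++ R ↭ x ∷ boxes bs ++ dias ds ++ R′ → Occurrence bs ds R x

locate : ∀ bs ds R → x ∈ boxes bs ++ dias ds ++ R → Occurrence bs ds R x
locate bs ds R x∈ with ∈-++⁻ (boxes bs) x∈
... | inj₁ x∈bs with (ρ , σ) , b∈ , refl ← ∈-map⁻ _ x∈bs with bs′ , p ← ∈⇒↭ b∈ =
  in-boxes ρ σ bs′ p refl (++⁺ʳ _ (map⁺ _ p))
... | inj₂ x∈′ with ∈-++⁻ (dias ds) x∈′
...   | inj₁ x∈ds with (ρ , σ) , d∈ , refl ← ∈-map⁻ _ x∈ds with ds′ , p ← ∈⇒↭ d∈ =
  in-dias ρ σ ds′ p refl (prefix-focus (boxes bs) (++⁺ʳ R (map⁺ _ p)))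
...   | inj₂ x∈R with R′ , p ← ∈⇒↭ x∈R =
  in-rest R′ p (prefix-focus (boxes bs) (prefix-focus (dias ds) p))

singleton-↭ : [ y ] ↭ x ∷ L → x ≡ y
singleton-↭ r with here eq ← ↭⇒∈ r = eq

[]-↭ : [] ↭ x ∷ L → ⊥
[]-↭ r with () ← ↭⇒∈ r

-- The two copies of a formula contracted in the conclusion of a ◇-rule, both lying in its modal block.
data Duplicate (x : Fm) (Γ Γ₀ : List Fm) (bs ds : List (Fm × Fm)) (φ ψ : Fm) : Set where
  dup-boxes : ∀ ρ σ bs′ bs″ → bs ↭ (ρ , σ) ∷ bs′ → bs′ ↭ (ρ , σ) ∷ bs″ → x ≡ (ρ □→ σ) →
    x ∷ Γ ↭ Γ₀ ++ boxes bs′ ++ dias ds ++ [ φ ◇→ ψ ] → Duplicate x Γ Γ₀ bs ds φ ψ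
  dup-dias : ∀ ρ σ ds′ ds″ → ds ↭ (ρ , σ) ∷ ds′ → ds′ ↭ (ρ , σ) ∷ ds″ → x ≡ (ρ ◇→ σ) →
    x ∷ Γ ↭ Γ₀ ++ boxes bs ++ dias ds′ ++ [ φ ◇→ ψ ] → Duplicate x Γ Γ₀ bs ds φ ψ
  dup-principal : ∀ ds′ → ds ↭ (φ , ψ) ∷ ds′ → x ≡ (φ ◇→ ψ) →
    x ∷ Γ ↭ Γ₀ ++ boxes bs ++ dias ds′ ++ [ φ ◇→ ψ ] → Duplicate x Γ Γ₀ bs ds φ ψ

duplicate : ∀ {M″} bs ds φ ψ → boxes bs ++ dias ds ++ [ φ ◇→ ψ ] ↭ x ∷ x ∷ M″ →
  Γ ↭ Γ₀ ++ M″ → Duplicate x Γ Γ₀ bs ds φ ψ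
duplicate {x} {Γ} {Γ₀} bs ds φ ψ p q with locate bs ds [ φ ◇→ ψ ] (↭⇒∈ p)
... | in-boxes ρ σ bs′ r refl t = second (locate bs′ ds [ φ ◇→ ψ ] (∈-resp-↭ rest (here refl)))
  where
  rest = drop-∷ (↭-trans (↭-sym p) t)
  second : Occurrence bs′ ds [ φ ◇→ ψ ] x → Duplicate x Γ Γ₀ bs ds φ ψ
  second (in-boxes _ _ bs″ r′ refl _) =
    dup-boxes ρ σ bs′ bs″ r r′ refl (↭-trans (prep _ q) (↭-trans (↭-sym (shift _ Γ₀ _)) (++⁺ˡ Γ₀ rest)))
  second (in-dias _ _ _ _ () _)
  second (in-rest _ r′ _) with () ← singleton-↭ r′
... | in-dias ρ σ ds′ r refl t = second (locate bs ds′ [ φ ◇→ ψ ] (∈-resp-↭ rest (here refl)))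
  where
  rest = drop-∷ (↭-trans (↭-sym p) t)
  context = ↭-trans (prep _ q) (↭-trans (↭-sym (shift _ Γ₀ _)) (++⁺ˡ Γ₀ rest))
  second : Occurrence bs ds′ [ φ ◇→ ψ ] x → Duplicate x Γ Γ₀ bs ds φ ψ
  second (in-boxes _ _ _ _ () _)
  second (in-dias _ _ ds″ r′ refl _) = dup-dias ρ σ ds′ ds″ r r′ refl context
  second (in-rest _ r′ _) with refl ← singleton-↭ r′ = dup-principal ds′ r refl context
... | in-rest R′ r t with refl ← singleton-↭ r | refl ← ↭-singleton-inv (↭-sym r) =
  second (locate bs ds [] (∈-resp-↭ rest (here refl)))
  where
  rest = drop-∷ (↭-trans (↭-sym p) t)
  second : Occurrence bs ds [] (φ ◇→ ψ) → Duplicate (φ ◇→ ψ) Γ Γ₀ bs ds φ ψ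
  second (in-boxes _ _ _ _ () _)
  second (in-dias _ _ ds′ r′ refl t′) = dup-principal ds′ r′ refl
    (↭-trans (prep _ q) (↭-trans (↭-sym (shift _ Γ₀ _)) (++⁺ˡ Γ₀ (↭-trans rest (↭-trans t′
      (↭-sym (prefix-focus (boxes bs) (shift _ (dias ds′) [])) ))))))
  second (in-rest _ r′ _) = ⊥-elim ([]-↭ r′)

init-∈ : ∀ {p} → var p ∈ Γ → D h Γ (just (var p))
init-∈ p∈ with _ , q ← ∈⇒↭ p∈ = init q

⊥L-∈ : ⊥̇ ∈ Γ → D h Γ Δ
⊥L-∈ ⊥∈ with _ , q ← ∈⇒↭ ⊥∈ = ⊥L q

∈-dedup : y ∈ x ∷ x ∷ Γ → y ∈ x ∷ Γ
∈-dedup (here eq) = here eq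
∈-dedup (there y∈) = y∈

contract : ∀ x → D h (x ∷ x ∷ Γ) Δ → D h (x ∷ Γ) Δ

contract-pair : ∀ {ρ σ : Fm} {bs bs′ bs″} (S : List Fm) {Z} → bs ↭ (ρ , σ) ∷ bs′ → bs′ ↭ (ρ , σ) ∷ bs″ →
  D h (S ++ map proj₂ bs ++ Z) Δ → D h (S ++ map proj₂ bs′ ++ Z) Δ
contract-pair {σ = σ} S {Z} r r′ d =
  exchange (↭-trans (↭-sym (shift _ S _)) (++⁺ˡ S (↭-sym (++⁺ʳ Z (map⁺ proj₂ r′)))))
    (contract σ (exchange (↭-trans (++⁺ˡ S (++⁺ʳ Z (map⁺ proj₂ (↭-trans r (prep _ r′))))) (shift₂ S)) d))

contract-principal : ∀ {ds ds′ : List (Fm × Fm)} (S : List Fm) → ds ↭ (φ , ψ) ∷ ds′ →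
  D h (S ++ map proj₂ ds ++ [ ψ ]) Δ → D h (S ++ map proj₂ ds′ ++ [ ψ ]) Δ
contract-principal {ψ = ψ} {ds′ = ds′} S r d =
  exchange (↭-trans (↭-sym (shift _ S _)) (++⁺ˡ S (↭-sym (++-comm (map proj₂ ds′) [ ψ ]))))
    (contract ψ (exchange (↭-trans (++⁺ˡ S (++⁺ʳ [ ψ ] (map⁺ proj₂ r)))
      (↭-trans (shift _ S _) (prep ψ (↭-trans (++⁺ˡ S (++-comm (map proj₂ ds′) [ ψ ])) (shift _ S _))))) d))

contract x (init π) = init-∈ (∈-dedup (↭⇒∈ π))
contract x (⊥L π) = ⊥L-∈ (∈-dedup (↭⇒∈ π))
contract x (∧L π d) with head₂-split π
... | inj₁ (refl , q) =
  ∧L ↭-refl (exchange swap-head (contract _ (exchange (↭-trans swap-head (prep _ swap-head))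
    (contract _ (exchange (prep _ swap-head) (∧L-inv _ _ (exchange (↭-trans (prep _ (prep _ q)) (↭-sym sink₂)) d)))))))
... | inj₂ (_ , p , q) =
  ∧L (cons-focus q) (exchange sink₂
    (contract x (exchange (↭-trans (prep _ (prep _ p)) (↭-sym (↭-trans (prep _ sink₂) sink₂))) d)))
contract x (∧R d e) = ∧R (contract x d) (contract x e)
contract x (∨L π d e) with head₂-split π
... | inj₁ (refl , q) =
  ∨L ↭-refl (contract _ (∨L-inv₁ _ _ (exchange (↭-trans (prep _ q) swap-head) d)))
            (contract _ (∨L-inv₂ _ _ (exchange (↭-trans (prep _ q) swap-head) e)))
... | inj₂ (_ , p , q) =
  ∨L (cons-focus q) (exchange swap-head (contract x (exchange (↭-trans (prep _ p) sink₂) d)))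
                    (exchange swap-head (contract x (exchange (↭-trans (prep _ p) sink₂) e)))
contract x (∨R₁ d) = ∨R₁ (contract x d)
contract x (∨R₂ d) = ∨R₂ (contract x d)
contract x (⊃R d) = ⊃R (exchange swap-head (contract x (exchange sink₂ d)))
contract x (⊃L π d e) with head₂-split π
... | inj₁ (refl , q) =
  ⊃L ↭-refl (contract _ (exchange (prep _ q) d))
            (contract _ (⊃L-inv _ _ (exchange (↭-trans (prep _ q) swap-head) e)))
... | inj₂ (_ , p , q) =
  ⊃L (cons-focus q) (exchange swap-head (contract x (exchange (↭-trans (prep _ p) sink₂) d)))
                    (exchange swap-head (contract x (exchange (↭-trans (prep _ p) sink₂) e)))
contract x (□R {Γ₀ = Γ₀} bs π l r c) with ++-split₂ Γ₀ π
... | inj₁ (Γ₁ , q) = □R {Γ₀ = Γ₁} bs q l r c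
... | inj₂ (_ , p , q) with ↭-map-inv _ p
...   | (ρ , σ) ∷ (_ , _) ∷ bs″ , refl , r′ =
  □R {Γ₀ = Γ₀} ((ρ , σ) ∷ bs″) (↭-trans (prep _ q) (↭-sym (shift _ Γ₀ _)))
     (drop-second (All-resp-↭ r′ l)) (drop-second (All-resp-↭ r′ r))
     (contract σ (exchange (map⁺ proj₂ r′) c))
  where
  drop-second : ∀ {P : Fm × Fm → Set} {b bs} → All P (b ∷ b ∷ bs) → All P (b ∷ bs)
  drop-second (pb ∷ _ ∷ pbs) = pb ∷ pbs
contract x (◇cem {Γ₀ = Γ₀} {φ = φ} {ψ = ψ} bs ds π lb rb ld rd e f g) with ++-split₂ Γ₀ π
... | inj₁ (Γ₁ , q) = ◇cem {Γ₀ = Γ₁} bs ds q lb rb ld rd e f g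
... | inj₂ (_ , p , q) with duplicate bs ds φ ψ p q
...   | dup-boxes _ _ _ _ r r′ refl u =
  ◇cem {Γ₀ = Γ₀} _ ds u (All.tail (All-resp-↭ r lb)) (All.tail (All-resp-↭ r rb)) ld rd e f
    (contract-pair [] r r′ g)
...   | dup-dias _ _ _ _ r r′ refl u =
  ◇cem {Γ₀ = Γ₀} bs _ u lb rb (All.tail (All-resp-↭ r ld)) (All.tail (All-resp-↭ r rd)) e f
    (contract-pair (map proj₂ bs) r r′ g)
...   | dup-principal _ r refl u =
  ◇cem {Γ₀ = Γ₀} bs _ u lb rb (All.tail (All-resp-↭ r ld)) (All.tail (All-resp-↭ r rd)) e f
    (contract-principal (map proj₂ bs) r g)
contract x (□◇cem {Γ₀ = Γ₀} {φ = φ} {ψ = ψ} bs ds π lb rb ld rd g) with ++-split₂ Γ₀ π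
... | inj₁ (Γ₁ , q) = □◇cem {Γ₀ = Γ₁} bs ds q lb rb ld rd g
... | inj₂ (_ , p , q) with duplicate bs ds φ ψ p q
...   | dup-boxes _ _ _ _ r r′ refl u =
  □◇cem {Γ₀ = Γ₀} _ ds u (All.tail (All-resp-↭ r lb)) (All.tail (All-resp-↭ r rb)) ld rd
    (contract-pair [] r r′ g)
...   | dup-dias _ _ _ _ r r′ refl u =
  □◇cem {Γ₀ = Γ₀} bs _ u lb rb (All.tail (All-resp-↭ r ld)) (All.tail (All-resp-↭ r rd))
    (contract-pair (map proj₂ bs) r r′ g)
...   | dup-principal _ r refl u =
  □◇cem {Γ₀ = Γ₀} bs _ u lb rb (All.tail (All-resp-↭ r ld)) (All.tail (All-resp-↭ r rd))
    (contract-principal (map proj₂ bs) r g)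

contract-++ : ∀ Γ → D h (Γ ++ Γ ++ L) Δ → D h (Γ ++ L) Δ
contract-++ [] d = d
contract-++ {L = L} (x ∷ Γ) d =
  contract x (exchange (shift₂ Γ)
    (contract-++ Γ (exchange
      (solve 3 (λ X G L → (X ⊕ G) ⊕ (X ⊕ G) ⊕ L ⊜ G ⊕ G ⊕ X ⊕ X ⊕ L) ↭-refl [ x ] Γ L) d)))

contract-all : ∀ Γ → D h (Γ ++ Γ) Δ → D h Γ Δ
contract-all Γ d = exchange (↭-reflexive (++-identityʳ Γ))
  (contract-++ Γ (exchange (↭-reflexive (≡.cong (Γ ++_) (≡.sym (++-identityʳ Γ)))) d))

-- Derivability without heights

Upward : (ℕ → Set) → Set
Upward P = ∀ {h h′} → h ≤ h′ → P h → P h′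

join : ∀ {P Q : ℕ → Set} → Upward P → Upward Q → ∃ P → ∃ Q → ∃ λ h → P h × Q h
join P↑ Q↑ (h , p) (h′ , q) = h ⊔ h′ , P↑ (m≤m⊔n h h′) p , Q↑ (m≤n⊔m h h′) q

×-upward : ∀ {P Q : ℕ → Set} → Upward P → Upward Q → Upward (λ h → P h × Q h)
×-upward P↑ Q↑ le (p , q) = P↑ le p , Q↑ le q

exchangeᵈ : Γ ↭ Γ′ → Derivable Γ Δ → Derivable Γ′ Δ
exchangeᵈ σ (h , d) = h , exchange σ d

weakenLᵈ : ∀ φ → Derivable Γ Δ → Derivable (φ ∷ Γ) Δ
weakenLᵈ φ (h , d) = h , weakenL φ d

weakenL-++ʳᵈ : ∀ L → Derivable Γ Δ → Derivable (Γ ++ L) Δ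
weakenL-++ʳᵈ L (h , d) = h , weakenL-++ʳ L d

∧Lᵈ : Γ ↭ (A ∧̇ B) ∷ Γ₀ → Derivable (A ∷ B ∷ Γ₀) Δ → Derivable Γ Δ
∧Lᵈ π (h , d) = suc h , ∧L π d

∧Rᵈ : Derivable Γ (just A) → Derivable Γ (just B) → Derivable Γ (just (A ∧̇ B))
∧Rᵈ d e with h , d′ , e′ ← join raise raise d e = suc h , ∧R d′ e′

∨Lᵈ : Γ ↭ (A ∨̇ B) ∷ Γ₀ → Derivable (A ∷ Γ₀) Δ → Derivable (B ∷ Γ₀) Δ → Derivable Γ Δ
∨Lᵈ π d e with h , d′ , e′ ← join raise raise d e = suc h , ∨L π d′ e′

∨R₁ᵈ : Derivable Γ (just A) → Derivable Γ (just (A ∨̇ B))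
∨R₁ᵈ (h , d) = suc h , ∨R₁ d

∨R₂ᵈ : Derivable Γ (just B) → Derivable Γ (just (A ∨̇ B))
∨R₂ᵈ (h , d) = suc h , ∨R₂ d

⊃Rᵈ : Derivable (A ∷ Γ) (just B) → Derivable Γ (just (A ⊃ B))
⊃Rᵈ (h , d) = suc h , ⊃R d

⊃Lᵈ : Γ ↭ (A ⊃ B) ∷ Γ₀ → Derivable ((A ⊃ B) ∷ Γ₀) (just A) → Derivable (B ∷ Γ₀) Δ → Derivable Γ Δ
⊃Lᵈ π d e with h , d′ , e′ ← join raise raise d e = suc h , ⊃L π d′ e′

_⟺[_]_ : Fm → ℕ → Fm → Set
φ ⟺[ h ] ρ = D h [ φ ] (just ρ) × D h [ ρ ] (just φ)

_⟺_ : Fm → Fm → Set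
φ ⟺ ρ = ∃ (φ ⟺[_] ρ)

⟺-sym : φ ⟺ ψ → ψ ⟺ φ
⟺-sym (h , l , r) = h , r , l

Equivalents : Fm → List (Fm × Fm) → Set
Equivalents φ = All (λ b → φ ⟺ proj₁ b)

equivalents : All (λ b → D h [ φ ] (just (proj₁ b))) bs → All (λ b → D h [ proj₁ b ] (just φ)) bs →
  Equivalents φ bs
equivalents {h} [] [] = []
equivalents {h} (l ∷ ls) (r ∷ rs) = (h , l , r) ∷ equivalents ls rs

⟺-raise : ∀ {ρ} → Upward (φ ⟺[_] ρ)
⟺-raise le (l , r) = raise le l , raise le r

equivalents-raise : Upward (λ h → All (λ b → φ ⟺[ h ] proj₁ b) bs)
equivalents-raise le [] = []
equivalents-raise le (e ∷ es) = ⟺-raise le e ∷ equivalents-raise le es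

uniformly : Equivalents φ bs → ∃ λ h → All (λ b → φ ⟺[ h ] proj₁ b) bs
uniformly [] = 0 , []
uniformly (e ∷ es) with h , e′ , es′ ← join ⟺-raise equivalents-raise e (uniformly es) = h , e′ ∷ es′

□Rᵈ : ∀ bs → Γ ↭ Γ₀ ++ boxes bs → Equivalents φ bs → Derivable (map proj₂ bs) (just ψ) →
  Derivable Γ (just (φ □→ ψ))
□Rᵈ {Γ₀ = Γ₀} bs π es c with h , es′ , c′ ← join equivalents-raise raise (uniformly es) c =
  suc h , □R {Γ₀ = Γ₀} bs π (All.map proj₁ es′) (All.map proj₂ es′) c′

-- How the succedent of a ◇-rule relates to that of its premiss: ◇cem or □◇cem.
data ◇Succedent (φ : Fm) : Maybe Fm → Maybe Fm → Set where
  ◇cem-succedent : ∀ {η ϑ} → φ ⟺ η → ◇Succedent φ (just (η ◇→ ϑ)) (just ϑ)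
  □◇cem-succedent : ◇Succedent φ Δ nothing

◇Rᵈ : ∀ {Δ′} bs ds → Γ ↭ Γ₀ ++ boxes bs ++ dias ds ++ [ φ ◇→ ψ ] → Equivalents φ bs → Equivalents φ ds →
  ◇Succedent φ Δ Δ′ → Derivable (map proj₂ bs ++ map proj₂ ds ++ [ ψ ]) Δ′ → Derivable Γ Δ
◇Rᵈ {Γ₀ = Γ₀} bs ds π eb ed (◇cem-succedent e) g
  with h , ((eb′ , ed′) , e′) , g′ ←
    join (×-upward (×-upward equivalents-raise equivalents-raise) ⟺-raise) raise
      (join (×-upward equivalents-raise equivalents-raise) ⟺-raise
        (join equivalents-raise equivalents-raise (uniformly eb) (uniformly ed)) e) g =
  suc h , ◇cem {Γ₀ = Γ₀} bs ds π (All.map proj₁ eb′) (All.map proj₂ eb′) (All.map proj₁ ed′)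
                                  (All.map proj₂ ed′) (proj₁ e′) (proj₂ e′) g′
◇Rᵈ {Γ₀ = Γ₀} bs ds π eb ed □◇cem-succedent g
  with h , (eb′ , ed′) , g′ ←
    join (×-upward equivalents-raise equivalents-raise) raise
      (join equivalents-raise equivalents-raise (uniformly eb) (uniformly ed)) g =
  suc h , □◇cem {Γ₀ = Γ₀} bs ds π (All.map proj₁ eb′) (All.map proj₂ eb′) (All.map proj₁ ed′)
                                   (All.map proj₂ ed′) g′

-- Cut

private variable
  bs₁ ds₁ : List (Fm × Fm)

boxes-++ : ∀ bs ds → boxes (bs ++ ds) ≡ boxes bs ++ boxes ds
boxes-++ = map-++ _

dias-++ : ∀ bs ds → dias (bs ++ ds) ≡ dias bs ++ dias ds
dias-++ = map-++ _

sides-++ : ∀ (bs ds : List (Fm × Fm)) → map proj₂ (bs ++ ds) ≡ map proj₂ bs ++ map proj₂ ds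
sides-++ = map-++ proj₂

□R-merge : ∀ Γ₁ bs₁ Γ₀ bs → Γ ↭ Γ₁ ++ boxes bs₁ → Γ′ ↭ Γ₀ ++ boxes bs →
  Γ ++ Γ′ ↭ (Γ₁ ++ Γ₀) ++ boxes (bs₁ ++ bs)
□R-merge Γ₁ bs₁ Γ₀ bs π q rewrite boxes-++ bs₁ bs =
  ↭-trans (++⁺ π q)
    (solve 4 (λ G₁ B₁ G₀ B → (G₁ ⊕ B₁) ⊕ (G₀ ⊕ B) ⊜ (G₁ ⊕ G₀) ⊕ (B₁ ⊕ B)) ↭-refl
      Γ₁ (boxes bs₁) Γ₀ (boxes bs))

□R-◇-merge : ∀ Γ₁ bs₁ Γ₀ bs L → Γ ↭ Γ₁ ++ boxes bs₁ → Γ′ ↭ Γ₀ ++ boxes bs ++ L →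
  Γ ++ Γ′ ↭ (Γ₁ ++ Γ₀) ++ boxes (bs₁ ++ bs) ++ L
□R-◇-merge Γ₁ bs₁ Γ₀ bs L π q rewrite boxes-++ bs₁ bs =
  ↭-trans (++⁺ π q)
    (solve 5 (λ G₁ B₁ G₀ B R → (G₁ ⊕ B₁) ⊕ (G₀ ⊕ B ⊕ R) ⊜ (G₁ ⊕ G₀) ⊕ (B₁ ⊕ B) ⊕ R) ↭-refl
      Γ₁ (boxes bs₁) Γ₀ (boxes bs) L)

◇-side-merge : ∀ Γ₁ bs₁ ds₁ P₁ Γ₀ bs ds P →
  Γ ↭ Γ₁ ++ boxes bs₁ ++ dias ds₁ ++ [ P₁ ] → Γ′ ↭ Γ₀ ++ boxes bs ++ dias ds ++ [ P ] →
  Γ ++ Γ′ ↭ (Γ₁ ++ Γ₀) ++ boxes (bs₁ ++ bs) ++ (P₁ ∷ dias (ds₁ ++ ds)) ++ [ P ]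
◇-side-merge Γ₁ bs₁ ds₁ P₁ Γ₀ bs ds P π q
  rewrite boxes-++ bs₁ bs | dias-++ ds₁ ds =
  ↭-trans (++⁺ π q)
    (solve 8 (λ G₁ B₁ D₁ Q₁ G₀ B D Q → (G₁ ⊕ B₁ ⊕ D₁ ⊕ Q₁) ⊕ (G₀ ⊕ B ⊕ D ⊕ Q) ⊜
                                       (G₁ ⊕ G₀) ⊕ (B₁ ⊕ B) ⊕ (Q₁ ⊕ D₁ ⊕ D) ⊕ Q) ↭-refl
      Γ₁ (boxes bs₁) (dias ds₁) [ P₁ ] Γ₀ (boxes bs) (dias ds) [ P ])

◇-main-merge : ∀ Γ₁ bs₁ ds₁ P₁ Γ₀ bs ds →
  Γ ↭ Γ₁ ++ boxes bs₁ ++ dias ds₁ ++ [ P₁ ] → Γ′ ↭ Γ₀ ++ boxes bs ++ dias ds →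
  Γ ++ Γ′ ↭ (Γ₁ ++ Γ₀) ++ boxes (bs₁ ++ bs) ++ dias (ds₁ ++ ds) ++ [ P₁ ]
◇-main-merge Γ₁ bs₁ ds₁ P₁ Γ₀ bs ds π q
  rewrite boxes-++ bs₁ bs | dias-++ ds₁ ds =
  ↭-trans (++⁺ π q)
    (solve 7 (λ G₁ B₁ D₁ Q₁ G₀ B D → (G₁ ⊕ B₁ ⊕ D₁ ⊕ Q₁) ⊕ (G₀ ⊕ B ⊕ D) ⊜
                                     (G₁ ⊕ G₀) ⊕ (B₁ ⊕ B) ⊕ (D₁ ⊕ D) ⊕ Q₁) ↭-refl
      Γ₁ (boxes bs₁) (dias ds₁) [ P₁ ] Γ₀ (boxes bs) (dias ds))

□-◇-premiss-merge : ∀ bs₁ bs L → map proj₂ bs₁ ++ map proj₂ bs ++ L ↭ map proj₂ (bs₁ ++ bs) ++ L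
□-◇-premiss-merge bs₁ bs L rewrite sides-++ bs₁ bs = ↭-sym (++-assoc (map proj₂ bs₁) (map proj₂ bs) L)

◇-side-premiss-merge : ∀ bs₁ ds₁ ψ₁ bs ds ψ →
  (map proj₂ bs₁ ++ map proj₂ ds₁ ++ [ ψ₁ ]) ++ map proj₂ bs ++ map proj₂ ds ++ [ ψ ] ↭
  map proj₂ (bs₁ ++ bs) ++ ψ₁ ∷ map proj₂ (ds₁ ++ ds) ++ [ ψ ]
◇-side-premiss-merge bs₁ ds₁ ψ₁ bs ds ψ
  rewrite sides-++ bs₁ bs | sides-++ ds₁ ds =
  solve 6 (λ S₁ X₁ P₁ S X P → (S₁ ⊕ X₁ ⊕ P₁) ⊕ S ⊕ X ⊕ P ⊜ (S₁ ⊕ S) ⊕ P₁ ⊕ (X₁ ⊕ X) ⊕ P) ↭-refl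
    (map proj₂ bs₁) (map proj₂ ds₁) [ ψ₁ ] (map proj₂ bs) (map proj₂ ds) [ ψ ]

◇-main-premiss-merge : ∀ bs₁ ds₁ ψ₁ bs ds →
  (map proj₂ bs₁ ++ map proj₂ ds₁ ++ [ ψ₁ ]) ++ map proj₂ bs ++ map proj₂ ds ↭
  map proj₂ (bs₁ ++ bs) ++ map proj₂ (ds₁ ++ ds) ++ [ ψ₁ ]
◇-main-premiss-merge bs₁ ds₁ ψ₁ bs ds
  rewrite sides-++ bs₁ bs | sides-++ ds₁ ds =
  solve 5 (λ S₁ X₁ P₁ S X → (S₁ ⊕ X₁ ⊕ P₁) ⊕ S ⊕ X ⊜ (S₁ ⊕ S) ⊕ (X₁ ⊕ X) ⊕ P₁) ↭-refl
    (map proj₂ bs₁) (map proj₂ ds₁) [ ψ₁ ] (map proj₂ bs) (map proj₂ ds)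

weaken-modal-context : ∀ Γ₀ L → Γ ↭ Γ₀ ++ L → Γ ++ Γ′ ↭ (Γ₀ ++ Γ′) ++ L
weaken-modal-context {Γ′ = Γ′} Γ₀ L π =
  ↭-trans (++⁺ʳ Γ′ π) (solve 3 (λ G M G′ → (G ⊕ M) ⊕ G′ ⊜ (G ⊕ G′) ⊕ M) ↭-refl Γ₀ L Γ′)

prefix-modal-context : ∀ Γ → Γ′ ↭ Γ₁ ++ L → Γ ++ Γ′ ↭ (Γ ++ Γ₁) ++ L
prefix-modal-context {Γ₁ = Γ₁} Γ q = ↭-trans (++⁺ˡ Γ q) (↭-sym (++-assoc Γ Γ₁ _))

residual : ∀ Γ₀ {M M′ M₁} → M ↭ x ∷ M′ → Γ′ ↭ Γ₀ ++ M′ → M ↭ x ∷ M₁ → Γ′ ↭ Γ₀ ++ M₁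
residual Γ₀ p q u = ↭-trans q (++⁺ˡ Γ₀ (drop-∷ (↭-trans (↭-sym p) u)))

size : Fm → ℕ
size (var _) = 1
size ⊥̇ = 1
size (A ∧̇ B) = suc (size A + size B)
size (A ∨̇ B) = suc (size A + size B)
size (A ⊃ B) = suc (size A + size B)
size (A □→ B) = suc (size A + size B)
size (A ◇→ B) = suc (size A + size B)

Bounded : ℕ → List Fm → Set
Bounded n = All (λ φ → size φ ≤ n)

BoundedSuccedent : ℕ → Maybe Fm → Set
BoundedSuccedent n nothing = ⊤
BoundedSuccedent n (just φ) = size φ ≤ n

PairsBounded : ℕ → List (Fm × Fm) → Set
PairsBounded n = All (λ b → suc (size (proj₁ b) + size (proj₂ b)) ≤ n)

lhs-≤ : ∀ {a b n} → suc (a + b) ≤ n → a ≤ n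
lhs-≤ {a} {b} le = ≤-trans (m≤m+n a b) (≤-trans (n≤1+n _) le)

rhs-≤ : ∀ {a b n} → suc (a + b) ≤ n → b ≤ n
rhs-≤ {a} {b} le = ≤-trans (m≤n+m b a) (≤-trans (n≤1+n _) le)

lhs-< : ∀ {a b n} → suc (a + b) ≤ suc n → a ≤ n
lhs-< {a} {b} (s≤s le) = ≤-trans (m≤m+n a b) le

uncons-bounded : ∀ {n} → Bounded n Γ → Γ ↭ x ∷ Γ₁ → size x ≤ n × Bounded n Γ₁
uncons-bounded bΓ π with bx ∷ bΓ₁ ← All-resp-↭ π bΓ = bx , bΓ₁

sides-bounded : ∀ {n} → PairsBounded n bs → Bounded n (map proj₂ bs)
sides-bounded B = Allₚ.map⁺ (All.map rhs-≤ B)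

firsts-bounded : ∀ {n} → PairsBounded (suc n) bs → All (λ b → size (proj₁ b) ≤ n) bs
firsts-bounded = All.map lhs-<

□R-bounded : ∀ {n} Γ₀ bs → Bounded n Γ → Γ ↭ Γ₀ ++ boxes bs → PairsBounded n bs
□R-bounded Γ₀ bs bΓ π = Allₚ.map⁻ (Allₚ.++⁻ʳ Γ₀ (All-resp-↭ π bΓ))

□◇-bounded : ∀ {n} Γ₀ bs ds → Bounded n Γ → Γ ↭ Γ₀ ++ boxes bs ++ dias ds → PairsBounded n bs × PairsBounded n ds
□◇-bounded Γ₀ bs ds bΓ π with B ← Allₚ.++⁻ʳ Γ₀ (All-resp-↭ π bΓ) =
  Allₚ.map⁻ (Allₚ.++⁻ˡ (boxes bs) B) , Allₚ.map⁻ (Allₚ.++⁻ʳ (boxes bs) B)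

record ◇RuleBounded (n : ℕ) (bs ds : List (Fm × Fm)) (φ ψ : Fm) : Set where
  field
    boxes-bounded : PairsBounded n bs
    dias-bounded : PairsBounded n ds
    principal-bounded : suc (size φ + size ψ) ≤ n

  premiss-bounded : Bounded n (map proj₂ bs ++ map proj₂ ds ++ [ ψ ])
  premiss-bounded =
    Allₚ.++⁺ (sides-bounded boxes-bounded) (Allₚ.++⁺ (sides-bounded dias-bounded) (rhs-≤ principal-bounded ∷ []))

◇-rule-bounded : ∀ {n} Γ₀ bs ds → Bounded n Γ → Γ ↭ Γ₀ ++ boxes bs ++ dias ds ++ [ φ ◇→ ψ ] →
  ◇RuleBounded n bs ds φ ψ
◇-rule-bounded Γ₀ bs ds bΓ π with B ← Allₚ.++⁻ʳ Γ₀ (All-resp-↭ π bΓ) = record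
  { boxes-bounded = Allₚ.map⁻ (Allₚ.++⁻ˡ (boxes bs) B)
  ; dias-bounded = Allₚ.map⁻ (Allₚ.++⁻ˡ (dias ds) (Allₚ.++⁻ʳ (boxes bs) B))
  ; principal-bounded = All.head (Allₚ.++⁻ʳ (dias ds) (Allₚ.++⁻ʳ (boxes bs) B))
  }

◇Succedent-bounded : ∀ {n Δ′} → ◇Succedent φ Δ Δ′ → BoundedSuccedent n Δ → BoundedSuccedent n Δ′
◇Succedent-bounded (◇cem-succedent _) bΔ = rhs-≤ bΔ
◇Succedent-bounded □◇cem-succedent bΔ = tt

CutAt : ℕ → Set
CutAt n = ∀ φ {h₁ h₂ Γ Γ′ Δ} → size φ ≤ n → Bounded n Γ → Bounded n Γ′ → BoundedSuccedent n Δ →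
  D h₁ Γ (just φ) → D h₂ (φ ∷ Γ′) Δ → Derivable (Γ ++ Γ′) Δ

⟺-trans : ∀ {n χ ρ} → CutAt n → size φ ≤ n → size χ ≤ n → size ρ ≤ n → φ ⟺ χ → χ ⟺ ρ → φ ⟺ ρ
⟺-trans cut bφ bχ bρ (_ , φ⇒χ , χ⇒φ) (_ , χ⇒ρ , ρ⇒χ) =
  join raise raise (cut _ bχ (bφ ∷ []) [] bρ φ⇒χ χ⇒ρ) (cut _ bχ (bρ ∷ []) [] bφ ρ⇒χ χ⇒φ)

⟺-trans-All : ∀ {n χ} → CutAt n → size φ ≤ n → size χ ≤ n → All (λ b → size (proj₁ b) ≤ n) bs →
  φ ⟺ χ → Equivalents χ bs → Equivalents φ bs
⟺-trans-All cut bφ bχ [] e [] = []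
⟺-trans-All cut bφ bχ (bρ ∷ bρs) e (e′ ∷ es) = ⟺-trans cut bφ bχ bρ e e′ ∷ ⟺-trans-All cut bφ bχ bρs e es

◇Succedent-trans : ∀ {n χ Δ′} → CutAt n → size φ ≤ n → size χ ≤ n → BoundedSuccedent (suc n) Δ →
  φ ⟺ χ → ◇Succedent χ Δ Δ′ → ◇Succedent φ Δ Δ′
◇Succedent-trans cut bφ bχ bΔ e (◇cem-succedent e′) = ◇cem-succedent (⟺-trans cut bφ bχ (lhs-< bΔ) e e′)
◇Succedent-trans cut bφ bχ bΔ e □◇cem-succedent = □◇cem-succedent

-- A derivation of φ ∷ Γ ⇒ Δ whose last rule has φ principal, with φ removed from the antecedent.
-- In the ⊃ case the left premiss is replaced by the cuts of φ against it: these have the same cut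
-- formula and are justified by the height of that premiss, which this type does not record.
data RightPrincipal (n : ℕ) : Fm → List Fm → Maybe Fm → Set where
  ⊥-principal : RightPrincipal n ⊥̇ Γ Δ
  ∧-principal : D h (A ∷ B ∷ Γ) Δ → RightPrincipal n (A ∧̇ B) Γ Δ
  ∨-principal : D h (A ∷ Γ) Δ → D h (B ∷ Γ) Δ → RightPrincipal n (A ∨̇ B) Γ Δ
  ⊃-principal : (∀ {h Γ′} → Bounded n Γ′ → D h Γ′ (just (A ⊃ B)) → Derivable (Γ′ ++ Γ) (just A)) →
    D h (B ∷ Γ) Δ → RightPrincipal n (A ⊃ B) Γ Δ
  □-principal-in-□R : ∀ {C E} bs → Γ ↭ Γ₀ ++ boxes bs → Equivalents φ ((C , E) ∷ bs) →
    Derivable (E ∷ map proj₂ bs) (just ψ) → RightPrincipal n (C □→ E) Γ (just (φ □→ ψ))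
  □-principal-in-◇ : ∀ {C E Δ′} bs ds → Γ ↭ Γ₀ ++ boxes bs ++ dias ds ++ [ φ ◇→ ψ ] →
    Equivalents φ ((C , E) ∷ bs) → Equivalents φ ds → ◇Succedent φ Δ Δ′ →
    Derivable (E ∷ map proj₂ bs ++ map proj₂ ds ++ [ ψ ]) Δ′ → RightPrincipal n (C □→ E) Γ Δ
  ◇-principal-side : ∀ {η ϑ Δ′} bs ds → Γ ↭ Γ₀ ++ boxes bs ++ dias ds ++ [ φ ◇→ ψ ] →
    Equivalents φ bs → Equivalents φ ((η , ϑ) ∷ ds) → ◇Succedent φ Δ Δ′ →
    Derivable (ϑ ∷ map proj₂ bs ++ map proj₂ ds ++ [ ψ ]) Δ′ → RightPrincipal n (η ◇→ ϑ) Γ Δ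
  ◇-principal-main : ∀ {Δ′} bs ds → Γ ↭ Γ₀ ++ boxes bs ++ dias ds →
    Equivalents φ bs → Equivalents φ ds → ◇Succedent φ Δ Δ′ →
    Derivable (ψ ∷ map proj₂ bs ++ map proj₂ ds) Δ′ → RightPrincipal n (φ ◇→ ψ) Γ Δ

cut : ∀ n → CutAt n

cutPrincipal : ∀ n φ {h₁ Γ Γ′ Δ} → size φ ≤ n → Bounded n Γ → Bounded n Γ′ → BoundedSuccedent n Δ →
  D h₁ Γ (just φ) → RightPrincipal n φ Γ′ Δ → Derivable (Γ ++ Γ′) Δ

cut-◇rule : ∀ n φ {h₁ Γ Γ′ Δ Δ′ φ₂ ψ₂} Γ₀ bs ds →
  size φ ≤ n → Bounded n Γ → Bounded n Γ′ → BoundedSuccedent n Δ →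
  D h₁ Γ (just φ) → φ ∷ Γ′ ↭ Γ₀ ++ boxes bs ++ dias ds ++ [ φ₂ ◇→ ψ₂ ] →
  Equivalents φ₂ bs → Equivalents φ₂ ds → ◇Succedent φ₂ Δ Δ′ →
  Derivable (map proj₂ bs ++ map proj₂ ds ++ [ ψ₂ ]) Δ′ → Derivable (Γ ++ Γ′) Δ

cut n φ {Γ = Γ} bφ bΓ bΓ′ bΔ d₁ (init π) with head-split π
... | inj₁ (refl , q) = -, weakenL-++ʳ _ d₁
... | inj₂ (_ , _ , q) = 0 , init (prefix-focus Γ q)
cut n φ {Γ = Γ} bφ bΓ bΓ′ bΔ d₁ (⊥L π) with head-split π
... | inj₁ (refl , q) = cutPrincipal n ⊥̇ bφ bΓ bΓ′ bΔ d₁ ⊥-principal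
... | inj₂ (_ , _ , q) = 0 , ⊥L (prefix-focus Γ q)
cut n φ {Γ = Γ} bφ bΓ bΓ′ bΔ d₁ (∧L π d) with head-split π
... | inj₁ (refl , q) = cutPrincipal n _ bφ bΓ bΓ′ bΔ d₁ (∧-principal (exchange (prep _ (prep _ (↭-sym q))) d))
... | inj₂ (_ , p , q) with bx , bΓ₁ ← uncons-bounded bΓ′ q =
  ∧Lᵈ (prefix-focus Γ q) (exchangeᵈ (shift₂ Γ)
    (cut n φ bφ bΓ (lhs-≤ bx ∷ rhs-≤ bx ∷ bΓ₁) bΔ d₁ (exchange (↭-trans (prep _ (prep _ p)) (↭-sym sink₂)) d)))
cut n φ bφ bΓ bΓ′ bΔ d₁ (∧R d e) = ∧Rᵈ (cut n φ bφ bΓ bΓ′ (lhs-≤ bΔ) d₁ d) (cut n φ bφ bΓ bΓ′ (rhs-≤ bΔ) d₁ e)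
cut n φ {Γ = Γ} bφ bΓ bΓ′ bΔ d₁ (∨L π d e) with head-split π
... | inj₁ (refl , q) =
  cutPrincipal n _ bφ bΓ bΓ′ bΔ d₁ (∨-principal (exchange (prep _ (↭-sym q)) d) (exchange (prep _ (↭-sym q)) e))
... | inj₂ (_ , p , q) with bx , bΓ₁ ← uncons-bounded bΓ′ q =
  ∨Lᵈ (prefix-focus Γ q)
    (exchangeᵈ (shift _ Γ _) (cut n φ bφ bΓ (lhs-≤ bx ∷ bΓ₁) bΔ d₁ (exchange (↭-trans (prep _ p) swap-head) d)))
    (exchangeᵈ (shift _ Γ _) (cut n φ bφ bΓ (rhs-≤ bx ∷ bΓ₁) bΔ d₁ (exchange (↭-trans (prep _ p) swap-head) e)))
cut n φ bφ bΓ bΓ′ bΔ d₁ (∨R₁ d) = ∨R₁ᵈ (cut n φ bφ bΓ bΓ′ (lhs-≤ bΔ) d₁ d)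
cut n φ bφ bΓ bΓ′ bΔ d₁ (∨R₂ d) = ∨R₂ᵈ (cut n φ bφ bΓ bΓ′ (rhs-≤ bΔ) d₁ d)
cut n φ {Γ = Γ} bφ bΓ bΓ′ bΔ d₁ (⊃R d) =
  ⊃Rᵈ (exchangeᵈ (shift _ Γ _) (cut n φ bφ bΓ (lhs-≤ bΔ ∷ bΓ′) (rhs-≤ bΔ) d₁ (exchange swap-head d)))
cut n φ {Γ = Γ} bφ bΓ bΓ′ bΔ d₁ (⊃L π d e) with head-split π
... | inj₁ (refl , q) =
  cutPrincipal n _ bφ bΓ bΓ′ bΔ d₁
    (⊃-principal (λ bΓ₂ d₂ → cut n _ bφ bΓ₂ bΓ′ (lhs-≤ bφ) d₂ (exchange (prep _ (↭-sym q)) d))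
                 (exchange (prep _ (↭-sym q)) e))
... | inj₂ (_ , p , q) with bx , bΓ₁ ← uncons-bounded bΓ′ q =
  ⊃Lᵈ (prefix-focus Γ q)
    (exchangeᵈ (shift _ Γ _) (cut n φ bφ bΓ (bx ∷ bΓ₁) (lhs-≤ bx) d₁ (exchange (↭-trans (prep _ p) swap-head) d)))
    (exchangeᵈ (shift _ Γ _) (cut n φ bφ bΓ (rhs-≤ bx ∷ bΓ₁) bΔ d₁ (exchange (↭-trans (prep _ p) swap-head) e)))
cut n φ {Γ = Γ} bφ bΓ bΓ′ bΔ d₁ (□R {Γ₀ = Γ₀} bs π fwd bwd c) with ++-split Γ₀ π
... | inj₁ (Γ₁ , _ , q) = -, □R {Γ₀ = Γ ++ Γ₁} bs (prefix-modal-context Γ q) fwd bwd c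
... | inj₂ (_ , p , q) with (C , E) ∷ bs′ , refl , r ← ↭-map-inv _ p =
  cutPrincipal n _ bφ bΓ bΓ′ bΔ d₁
    (□-principal-in-□R bs′ q (All-resp-↭ r (equivalents fwd bwd)) (-, exchange (map⁺ proj₂ r) c))
cut n φ bφ bΓ bΓ′ bΔ d₁ (◇cem {Γ₀ = Γ₀} bs ds π fb bb fd bd e f g) =
  cut-◇rule n φ Γ₀ bs ds bφ bΓ bΓ′ bΔ d₁ π (equivalents fb bb) (equivalents fd bd)
    (◇cem-succedent (-, e , f)) (-, g)
cut n φ bφ bΓ bΓ′ bΔ d₁ (□◇cem {Γ₀ = Γ₀} bs ds π fb bb fd bd g) =
  cut-◇rule n φ Γ₀ bs ds bφ bΓ bΓ′ bΔ d₁ π (equivalents fb bb) (equivalents fd bd) □◇cem-succedent (-, g)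

cut-◇rule n φ {Γ = Γ} {φ₂ = φ₂} {ψ₂} Γ₀ bs ds bφ bΓ bΓ′ bΔ d₁ π eb ed t g with ++-split Γ₀ π
... | inj₁ (Γ₁ , _ , q) = ◇Rᵈ {Γ₀ = Γ ++ Γ₁} bs ds (prefix-modal-context Γ q) eb ed t g
... | inj₂ (_ , p , q) with locate bs ds [ φ₂ ◇→ ψ₂ ] (↭⇒∈ p)
...   | in-boxes C E bs′ r refl u =
  cutPrincipal n _ bφ bΓ bΓ′ bΔ d₁
    (□-principal-in-◇ {Γ₀ = Γ₀} bs′ ds (residual Γ₀ p q u) (All-resp-↭ r eb) ed t
      (exchangeᵈ (++⁺ʳ _ (map⁺ proj₂ r)) g))
...   | in-dias η ϑ ds′ r refl u =
  cutPrincipal n _ bφ bΓ bΓ′ bΔ d₁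
    (◇-principal-side {Γ₀ = Γ₀} bs ds′ (residual Γ₀ p q u) eb (All-resp-↭ r ed) t
      (exchangeᵈ (↭-trans (++⁺ˡ (map proj₂ bs) (++⁺ʳ [ ψ₂ ] (map⁺ proj₂ r))) (shift _ (map proj₂ bs) _)) g))
-- φ is transported rather than unified with φ₂ ◇→ ψ₂, so that the termination checker sees it unchanged.
...   | in-rest R′ r u with refl ← ∷-injectiveʳ (↭-singleton-inv (↭-sym r)) =
  cutPrincipal n φ bφ bΓ bΓ′ bΔ d₁ (subst (λ χ → RightPrincipal n χ _ _) (≡.sym (singleton-↭ r))
    (◇-principal-main {Γ₀ = Γ₀} bs ds
      (↭-trans (residual Γ₀ p q u) (++⁺ˡ Γ₀ (++⁺ˡ (boxes bs) (↭-reflexive (++-identityʳ (dias ds))))))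
      eb ed t
      (exchangeᵈ (↭-trans (↭-sym (++-assoc (map proj₂ bs) (map proj₂ ds) [ ψ₂ ])) (++-comm _ [ ψ₂ ])) g)))

cutPrincipal n φ bφ bΓ bΓ′ bΔ (⊥L π) rp = 0 , ⊥L (++⁺ʳ _ π)
cutPrincipal n φ bφ bΓ bΓ′ bΔ (∧L π d) rp with bx , bΓ₀ ← uncons-bounded bΓ π =
  ∧Lᵈ (++⁺ʳ _ π) (cutPrincipal n φ bφ (lhs-≤ bx ∷ rhs-≤ bx ∷ bΓ₀) bΓ′ bΔ d rp)
cutPrincipal n φ bφ bΓ bΓ′ bΔ (∨L π d e) rp with bx , bΓ₀ ← uncons-bounded bΓ π =
  ∨Lᵈ (++⁺ʳ _ π) (cutPrincipal n φ bφ (lhs-≤ bx ∷ bΓ₀) bΓ′ bΔ d rp)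
                 (cutPrincipal n φ bφ (rhs-≤ bx ∷ bΓ₀) bΓ′ bΔ e rp)
cutPrincipal n φ bφ bΓ bΓ′ bΔ (⊃L π d e) rp with bx , bΓ₀ ← uncons-bounded bΓ π =
  ⊃Lᵈ (++⁺ʳ _ π) (-, weakenL-++ʳ _ d) (cutPrincipal n φ bφ (rhs-≤ bx ∷ bΓ₀) bΓ′ bΔ e rp)
cutPrincipal n φ bφ bΓ bΓ′ bΔ (□◇cem {Γ₀ = Γ₀} bs ds π fb bb fd bd g) rp =
  -, □◇cem {Γ₀ = Γ₀ ++ _} bs ds (weaken-modal-context Γ₀ _ π) fb bb fd bd g
cutPrincipal n _ bφ bΓ bΓ′ bΔ (init _) ()
cutPrincipal n (A ∧̇ B) {Γ = Γ} bφ bΓ bΓ′ bΔ (∧R d e) (∧-principal d′)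
  = let _ , r = cut n A (lhs-≤ bφ) bΓ (rhs-≤ bφ ∷ bΓ′) bΔ d d′
        h , r′ = cut n B (rhs-≤ bφ) bΓ (Allₚ.++⁺ bΓ bΓ′) bΔ e (exchange (shift _ Γ _) r)
    in h , contract-++ Γ r′
cutPrincipal n (A ∨̇ B) bφ bΓ bΓ′ bΔ (∨R₁ d) (∨-principal d′ _) = cut n A (lhs-≤ bφ) bΓ bΓ′ bΔ d d′
cutPrincipal n (A ∨̇ B) bφ bΓ bΓ′ bΔ (∨R₂ e) (∨-principal _ e′) = cut n B (rhs-≤ bφ) bΓ bΓ′ bΔ e e′
cutPrincipal n (A ⊃ B) {Γ = Γ} {Γ′} bφ bΓ bΓ′ bΔ d₁@(⊃R d) (⊃-principal cut-left e′)
  = let _ , r₁ = cut-left bΓ d₁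
        _ , r₂ = cut n A (lhs-≤ bφ) (Allₚ.++⁺ bΓ bΓ′) bΓ (rhs-≤ bφ) r₁ d
        h , r₃ = cut n B (rhs-≤ bφ) (Allₚ.++⁺ (Allₚ.++⁺ bΓ bΓ′) bΓ) bΓ′ bΔ r₂ e′
    in h , contract-all (Γ ++ Γ′) (exchange (++-assoc (Γ ++ Γ′) Γ Γ′) r₃)
cutPrincipal zero (_ □→ _) () _ _ _ (□R _ _ _ _ _) _
cutPrincipal zero (_ ◇→ _) () _ _ _ (◇cem _ _ _ _ _ _ _ _ _ _) _
cutPrincipal (suc m) (C □→ E) bφ bΓ bΓ′ bΔ (□R {Γ₀ = Γ₁} bs₁ π₁ fwd₁ bwd₁ c₁)
  (□-principal-in-□R {Γ₀ = Γ₀} bs q (e ∷ es) (_ , c)) =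
  □Rᵈ {Γ₀ = Γ₁ ++ Γ₀} (bs₁ ++ bs) (□R-merge Γ₁ bs₁ Γ₀ bs π₁ q)
    (Allₚ.++⁺ (⟺-trans-All (cut m) (lhs-< bΔ) (lhs-< bφ) (firsts-bounded B₁) e (equivalents fwd₁ bwd₁)) es)
    (exchangeᵈ (↭-reflexive (≡.sym (sides-++ bs₁ bs)))
      (cut (suc m) E (rhs-≤ bφ) (sides-bounded B₁) (sides-bounded (□R-bounded Γ₀ bs bΓ′ q)) (rhs-≤ bΔ) c₁ c))
  where B₁ = □R-bounded Γ₁ bs₁ bΓ π₁
cutPrincipal (suc m) (C □→ E) bφ bΓ bΓ′ bΔ (□R {Γ₀ = Γ₁} bs₁ π₁ fwd₁ bwd₁ c₁)
  (□-principal-in-◇ {Γ₀ = Γ₀} bs ds q (e ∷ es) eds t (_ , g)) =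
  ◇Rᵈ {Γ₀ = Γ₁ ++ Γ₀} (bs₁ ++ bs) ds (□R-◇-merge Γ₁ bs₁ Γ₀ bs _ π₁ q)
    (Allₚ.++⁺ (⟺-trans-All (cut m) (lhs-< R.principal-bounded) (lhs-< bφ) (firsts-bounded B₁) e
                (equivalents fwd₁ bwd₁)) es)
    eds t
    (exchangeᵈ (□-◇-premiss-merge bs₁ bs _)
      (cut (suc m) E (rhs-≤ bφ) (sides-bounded B₁) R.premiss-bounded (◇Succedent-bounded t bΔ) c₁ g))
  where
  B₁ = □R-bounded Γ₁ bs₁ bΓ π₁
  module R = ◇RuleBounded (◇-rule-bounded Γ₀ bs ds bΓ′ q)
cutPrincipal (suc m) (η ◇→ ϑ) bφ bΓ bΓ′ bΔ
  (◇cem {Γ₀ = Γ₁} {φ = φ₁} {ψ = ψ₁} bs₁ ds₁ π₁ fb₁ bb₁ fd₁ bd₁ e₁ f₁ g₁)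
  (◇-principal-side {Γ₀ = Γ₀} bs ds q eb (eη ∷ eds) t (_ , g)) =
  ◇Rᵈ {Γ₀ = Γ₁ ++ Γ₀} (bs₁ ++ bs) ((φ₁ , ψ₁) ∷ ds₁ ++ ds) (◇-side-merge Γ₁ bs₁ ds₁ _ Γ₀ bs ds _ π₁ q)
    (Allₚ.++⁺ (through-φ₁ L.boxes-bounded (equivalents fb₁ bb₁)) eb)
    (φ₂⟺φ₁ ∷ Allₚ.++⁺ (through-φ₁ L.dias-bounded (equivalents fd₁ bd₁)) eds) t
    (exchangeᵈ (◇-side-premiss-merge bs₁ ds₁ ψ₁ bs ds _)
      (cut (suc m) ϑ (rhs-≤ bφ) L.premiss-bounded R.premiss-bounded (◇Succedent-bounded t bΔ) g₁ g))
  where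
  module L = ◇RuleBounded (◇-rule-bounded Γ₁ bs₁ ds₁ bΓ π₁)
  module R = ◇RuleBounded (◇-rule-bounded Γ₀ bs ds bΓ′ q)
  φ₂⟺φ₁ = ⟺-trans (cut m) (lhs-< R.principal-bounded) (lhs-< bφ) (lhs-< L.principal-bounded) eη (-, f₁ , e₁)
  through-φ₁ : ∀ {bs} → PairsBounded (suc m) bs → Equivalents φ₁ bs → Equivalents _ bs
  through-φ₁ B =
    ⟺-trans-All (cut m) (lhs-< R.principal-bounded) (lhs-< L.principal-bounded) (firsts-bounded B) φ₂⟺φ₁
cutPrincipal (suc m) (η ◇→ ϑ) bφ bΓ bΓ′ bΔ
  (◇cem {Γ₀ = Γ₁} {φ = φ₁} {ψ = ψ₁} bs₁ ds₁ π₁ fb₁ bb₁ fd₁ bd₁ e₁ f₁ g₁)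
  (◇-principal-main {Γ₀ = Γ₀} bs ds q eb ed t (_ , g)) =
  ◇Rᵈ {Γ₀ = Γ₁ ++ Γ₀} (bs₁ ++ bs) (ds₁ ++ ds) (◇-main-merge Γ₁ bs₁ ds₁ _ Γ₀ bs ds π₁ q)
    (Allₚ.++⁺ (equivalents fb₁ bb₁) (through-η Bb eb)) (Allₚ.++⁺ (equivalents fd₁ bd₁) (through-η Bd ed))
    (◇Succedent-trans (cut m) (lhs-< L.principal-bounded) (lhs-< bφ) bΔ φ₁⟺η t)
    (exchangeᵈ (◇-main-premiss-merge bs₁ ds₁ ψ₁ bs ds)
      (cut (suc m) ϑ (rhs-≤ bφ) L.premiss-bounded (Allₚ.++⁺ (sides-bounded Bb) (sides-bounded Bd))
        (◇Succedent-bounded t bΔ) g₁ g))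
  where
  module L = ◇RuleBounded (◇-rule-bounded Γ₁ bs₁ ds₁ bΓ π₁)
  Bb = proj₁ (□◇-bounded Γ₀ bs ds bΓ′ q)
  Bd = proj₂ (□◇-bounded Γ₀ bs ds bΓ′ q)
  φ₁⟺η : φ₁ ⟺ η
  φ₁⟺η = -, e₁ , f₁
  through-η : ∀ {bs} → PairsBounded (suc m) bs → Equivalents η bs → Equivalents φ₁ bs
  through-η B = ⟺-trans-All (cut m) (lhs-< L.principal-bounded) (lhs-< bφ) (firsts-bounded B) φ₁⟺η

maxSize : List Fm → ℕ
maxSize [] = 0
maxSize (φ ∷ Γ) = size φ ⊔ maxSize Γ

bounded-by-maxSize : ∀ Γ → Bounded (maxSize Γ) Γ
bounded-by-maxSize [] = []
bounded-by-maxSize (φ ∷ Γ) =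
  m≤m⊔n _ _ ∷ All.map (λ le → ≤-trans le (m≤n⊔m (size φ) _)) (bounded-by-maxSize Γ)

bounded-succedent : ∀ {n} Δ → Bounded n (Maybe.maybe′ [_] [] Δ) → BoundedSuccedent n Δ
bounded-succedent nothing _ = tt
bounded-succedent (just φ) (bφ ∷ []) = bφ

cut-admissible : ∀ φ → Derivable Γ (just φ) → Derivable (φ ∷ Γ′) Δ → Derivable (Γ ++ Γ′) Δ
cut-admissible {Γ} {Γ′} {Δ} φ (_ , d₁) (_ , d₂)
  with bφ ∷ B ← bounded-by-maxSize (φ ∷ Γ ++ Γ′ ++ Maybe.maybe′ [_] [] Δ) =
  cut _ φ bφ (Allₚ.++⁻ˡ Γ B) (Allₚ.++⁻ˡ Γ′ (Allₚ.++⁻ʳ Γ B))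
    (bounded-succedent Δ (Allₚ.++⁻ʳ Γ′ (Allₚ.++⁻ʳ Γ B))) d₁ d₂

-- Soundness

-- Γ ⊩ φ: the Hilbert system proves φ under the hypotheses Γ, discharged by implications.
closure : List Fm → Fm → Fm
closure [] φ = φ
closure (A ∷ Γ) φ = closure Γ (A ⊃ φ)

record _⊩_ (Γ : List Fm) (φ : Fm) : Set where
  constructor ⊩-intro
  field ⊩-elim : ⊢H (closure Γ φ)
open _⊩_

infix 4 _⊩_

⊃-intro : (A ∷ Γ) ⊩ φ → Γ ⊩ (A ⊃ φ)
⊃-intro p = ⊩-intro (⊩-elim p)

⊃-elim : Γ ⊩ (A ⊃ φ) → (A ∷ Γ) ⊩ φ
⊃-elim p = ⊩-intro (⊩-elim p)

⊢-id : ∀ A → ⊢H (A ⊃ A)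
⊢-id A = mp (mp (ax-S A (A ⊃ A) A) (ax-K A (A ⊃ A))) (ax-K A A)

⊩-theorem : ⊢H φ → Γ ⊩ φ
⊩-theorem {Γ = []} p = ⊩-intro p
⊩-theorem {φ} {A ∷ Γ} p = ⊃-elim (⊩-theorem (mp (ax-K φ A) p))

⊩-mp : Γ ⊩ (φ ⊃ ψ) → Γ ⊩ φ → Γ ⊩ ψ
⊩-mp {Γ = []} p q = ⊩-intro (mp (⊩-elim p) (⊩-elim q))
⊩-mp {A ∷ Γ} {φ} {ψ} p q = ⊃-elim (⊩-mp (⊩-mp (⊩-theorem (ax-S A φ ψ)) (⊃-intro p)) (⊃-intro q))

⊩-weaken : Γ ⊩ φ → (A ∷ Γ) ⊩ φ
⊩-weaken {φ = φ} {A = A} p = ⊃-elim (⊩-mp (⊩-theorem (ax-K φ A)) p)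

⊩-hyp : φ ∈ Γ → Γ ⊩ φ
⊩-hyp {φ} (here refl) = ⊃-elim (⊩-theorem (⊢-id φ))
⊩-hyp (there φ∈) = ⊩-weaken (⊩-hyp φ∈)

⊩-subst : Γ ⊩ φ → All (Γ′ ⊩_) Γ → Γ′ ⊩ φ
⊩-subst {[]} p [] = ⊩-theorem (⊩-elim p)
⊩-subst {A ∷ Γ} p (q ∷ qs) = ⊩-mp (⊩-subst (⊃-intro p) qs) q

hypotheses : Γ ↭ L → All (Γ ⊩_) L
hypotheses π = All.tabulate (λ x∈ → ⊩-hyp (∈-resp-↭ (↭-sym π) x∈))

discharge : All (Γ ⊩_) Γ₀ → (A ∷ Γ₀) ⊩ φ → Γ ⊩ (A ⊃ φ)
discharge hs p = ⊃-intro (⊩-subst p (⊩-hyp (here refl) ∷ All.map ⊩-weaken hs))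

⊩-∧I : Γ ⊩ A → Γ ⊩ B → Γ ⊩ (A ∧̇ B)
⊩-∧I {A = A} {B} p q = ⊩-mp (⊩-mp (⊩-theorem (ax-∧I A B)) p) q

⊩-∧E₁ : Γ ⊩ (A ∧̇ B) → Γ ⊩ A
⊩-∧E₁ {A = A} {B} = ⊩-mp (⊩-theorem (ax-∧E₁ A B))

⊩-∧E₂ : Γ ⊩ (A ∧̇ B) → Γ ⊩ B
⊩-∧E₂ {A = A} {B} = ⊩-mp (⊩-theorem (ax-∧E₂ A B))

⊩-efq : Γ ⊩ ⊥̇ → Γ ⊩ φ
⊩-efq {φ = φ} = ⊩-mp (⊩-theorem (ax-EFQ φ))

⊩-⇔ : [ A ] ⊩ B → [ B ] ⊩ A → ⊢H (A ⇔̇ B)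
⊩-⇔ p q = ⊩-elim (⊩-∧I {Γ = []} (⊩-intro (⊩-elim p)) (⊩-intro (⊩-elim q)))

under-∧₂ : All ([ B ] ⊩_) L → All ([ A ∧̇ B ] ⊩_) L
under-∧₂ = All.map (λ p → ⊩-subst p (⊩-∧E₂ (⊩-hyp (here refl)) ∷ []))

⊩-⋀ : ∀ A Γ → All ([ ⋀ A Γ ] ⊩_) (A ∷ Γ)
⊩-⋀ A [] = ⊩-hyp (here refl) ∷ []
⊩-⋀ A (B ∷ Γ) = ⊩-∧E₁ (⊩-hyp (here refl)) ∷ under-∧₂ (⊩-⋀ B Γ)

conj : List Fm → Fm
conj [] = ⊤̇
conj (σ ∷ σs) = σ ∧̇ conj σs

⊩-conj : ∀ σs → All ([ conj σs ] ⊩_) σs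
⊩-conj [] = []
⊩-conj (σ ∷ σs) = ⊩-∧E₁ (⊩-hyp (here refl)) ∷ under-∧₂ (⊩-conj σs)

□-mono : ⊢H (A ⊃ B) → Γ ⊩ (φ □→ A) → Γ ⊩ (φ □→ B)
□-mono {A} {B} {φ = φ} A⊃B p =
  ⊩-∧E₂ (⊩-mp (⊩-theorem (CM□ φ A B)) (⊩-mp (⊩-theorem (mp (ax-∧E₁ _ _) (RC□ φ A⇔A∧B))) p))
  where
  A⇔A∧B : ⊢H (A ⇔̇ (A ∧̇ B))
  A⇔A∧B = ⊩-⇔ (⊩-∧I (⊩-hyp (here refl)) (⊩-mp (⊩-theorem A⊃B) (⊩-hyp (here refl)))) (⊩-∧E₁ (⊩-hyp (here refl)))

□-conj : All (λ b → ⊢H (φ ⇔̇ proj₁ b)) bs → All (Γ ⊩_) (boxes bs) → Γ ⊩ (φ □→ conj (map proj₂ bs))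
□-conj {φ} [] [] = ⊩-theorem (CN□ φ)
□-conj {φ} {(ρ , σ) ∷ bs} (e ∷ es) (h ∷ hs) =
  ⊩-mp (⊩-theorem (CC□ φ σ _)) (⊩-∧I (⊩-mp (⊩-theorem (mp (ax-∧E₂ _ _) (RA□ σ e))) h) (□-conj es hs))

◇-⋀ : All (λ b → ⊢H (φ ⇔̇ proj₁ b)) ds → All (Γ ⊩_) (dias ds) → Γ ⊩ (φ ◇→ ψ) →
  Γ ⊩ (φ ◇→ ⋀ ψ (map proj₂ ds))
◇-⋀ [] [] p = p
◇-⋀ {φ} {(ξ , χ) ∷ ds} {ψ = ψ} (e ∷ es) (h ∷ hs) p =
  ⊩-mp (⊩-theorem (CEM◇ φ ψ _)) (⊩-∧I p (◇-⋀ es hs (⊩-mp (⊩-theorem (mp (ax-∧E₂ _ _) (RA◇ χ e))) h)))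

sound-◇ : ∀ {ϑ} Γ₀ bs ds → Γ ↭ Γ₀ ++ boxes bs ++ dias ds ++ [ φ ◇→ ψ ] →
  All (λ b → ⊢H (φ ⇔̇ proj₁ b)) bs → All (λ b → ⊢H (φ ⇔̇ proj₁ b)) ds →
  (map proj₂ bs ++ map proj₂ ds ++ [ ψ ]) ⊩ ϑ → Γ ⊩ (φ ◇→ ϑ)
sound-◇ {φ = φ} {ψ} {ϑ} Γ₀ bs ds π eb ed p =
  ⊩-mp (⊩-mp (⊩-theorem (CK◇ φ (⋀ ψ χs) ϑ)) (□-mono premiss (□-conj eb (Allₚ.++⁻ˡ (boxes bs) hs))))
       (◇-⋀ ed (Allₚ.++⁻ˡ (dias ds) hs′) (All.head (Allₚ.++⁻ʳ (dias ds) hs′)))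
  where
  σs = map proj₂ bs
  χs = map proj₂ ds
  hs = Allₚ.++⁻ʳ Γ₀ (hypotheses π)
  hs′ = Allₚ.++⁻ʳ (boxes bs) hs
  premiss : ⊢H (conj σs ⊃ ⋀ ψ χs ⊃ ϑ)
  premiss = ⊩-elim (⊩-subst p (Allₚ.++⁺ (All.map ⊩-weaken (⊩-conj σs))
    (All-resp-↭ (++-comm [ ψ ] χs) (All.map (λ q → ⊩-subst q (⊩-hyp (here refl) ∷ [])) (⊩-⋀ ψ χs)))))

sound : D h Γ Δ → Γ ⊩ ⋁ Δ

sound-⇔ : All (λ b → D h [ φ ] (just (proj₁ b))) bs → All (λ b → D h [ proj₁ b ] (just φ)) bs →
  All (λ b → ⊢H (φ ⇔̇ proj₁ b)) bs
sound-⇔ [] [] = []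
sound-⇔ (l ∷ ls) (r ∷ rs) = ⊩-⇔ (sound l) (sound r) ∷ sound-⇔ ls rs

sound (init π) = ⊩-hyp (↭⇒∈ π)
sound (⊥L π) = ⊩-efq (⊩-hyp (↭⇒∈ π))
sound (∧L π d) with h ∷ hs ← hypotheses π = ⊩-subst (sound d) (⊩-∧E₁ h ∷ ⊩-∧E₂ h ∷ hs)
sound (∧R d e) = ⊩-∧I (sound d) (sound e)
sound {Δ = Δ} (∨L {φ = A} {ψ = B} π d e) with h ∷ hs ← hypotheses π =
  ⊩-mp (⊩-mp (⊩-mp (⊩-theorem (ax-∨E A B (⋁ Δ))) (discharge hs (sound d))) (discharge hs (sound e))) h
sound (∨R₁ d) = ⊩-mp (⊩-theorem (ax-∨I₁ _ _)) (sound d)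
sound (∨R₂ d) = ⊩-mp (⊩-theorem (ax-∨I₂ _ _)) (sound d)
sound (⊃R d) = ⊃-intro (sound d)
sound (⊃L π d e) with h ∷ hs ← hypotheses π = ⊩-subst (sound e) (⊩-mp h (⊩-subst (sound d) (h ∷ hs)) ∷ hs)
sound (□R {Γ₀ = Γ₀} bs π fwd bwd c) =
  □-mono (⊩-elim (⊩-subst (sound c) (⊩-conj (map proj₂ bs))))
         (□-conj (sound-⇔ fwd bwd) (Allₚ.++⁻ʳ Γ₀ (hypotheses π)))
sound (◇cem {Γ₀ = Γ₀} {ϑ = ϑ} bs ds π fb bb fd bd e f g) =
  ⊩-mp (⊩-theorem (mp (ax-∧E₁ _ _) (RA◇ ϑ (⊩-⇔ (sound e) (sound f)))))
    (sound-◇ Γ₀ bs ds π (sound-⇔ fb bb) (sound-⇔ fd bd) (sound g))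
sound (□◇cem {Γ₀ = Γ₀} {φ = φ} bs ds π fb bb fd bd g) =
  ⊩-efq (⊩-mp (⊩-theorem (CN◇ φ)) (sound-◇ Γ₀ bs ds π (sound-⇔ fb bb) (sound-⇔ fd bd) (sound g)))

⊩⇒ι : ∀ Γ Δ → Γ ⊩ ⋁ Δ → ⊢H (ι Γ Δ)
⊩⇒ι [] Δ p = ⊩-elim p
⊩⇒ι (A ∷ Γ) Δ p = ⊩-elim (⊩-subst p (⊩-⋀ A Γ))

-- Completeness

identity : ∀ A → Derivable [ A ] (just A)

⟺-refl : ∀ A → A ⟺ A
⟺-refl A = join raise raise (identity A) (identity A)

identity (var p) = 0 , init ↭-refl
identity ⊥̇ = 0 , ⊥L ↭-refl
identity (A ∧̇ B) = ∧Lᵈ ↭-refl (∧Rᵈ (weakenL-++ʳᵈ [ B ] (identity A)) (weakenLᵈ A (identity B)))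
identity (A ∨̇ B) = ∨Lᵈ ↭-refl (∨R₁ᵈ (identity A)) (∨R₂ᵈ (identity B))
identity (A ⊃ B) =
  ⊃Rᵈ (⊃Lᵈ {Γ₀ = [ A ]} swap-head (weakenLᵈ (A ⊃ B) (identity A)) (weakenL-++ʳᵈ [ A ] (identity B)))
identity (A □→ B) = □Rᵈ {Γ₀ = []} [ (A , B) ] ↭-refl (⟺-refl A ∷ []) (identity B)
identity (A ◇→ B) = ◇Rᵈ {Γ₀ = []} [] [] ↭-refl [] [] (◇cem-succedent (⟺-refl A)) (identity B)

axiom : A ∈ Γ → Derivable Γ (just A)
axiom {A} A∈ with Γ′ , p ← ∈⇒↭ A∈ = exchangeᵈ (↭-sym p) (weakenL-++ʳᵈ Γ′ (identity A))

contract-allᵈ : ∀ Γ → Derivable (Γ ++ Γ) Δ → Derivable Γ Δ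
contract-allᵈ Γ (h , d) = h , contract-all Γ d

mpᵈ : Derivable Γ (just (A ⊃ B)) → Derivable Γ (just A) → Derivable Γ (just B)
mpᵈ {Γ} {A} {B} A⊃B A′ =
  contract-allᵈ Γ
    (cut-admissible (A ⊃ B) A⊃B (⊃Lᵈ {Γ₀ = Γ} ↭-refl (weakenLᵈ (A ⊃ B) A′) (axiom (here refl))))

right-++-[] : Derivable (Γ ++ []) Δ → Derivable Γ Δ
right-++-[] {Γ} = exchangeᵈ (↭-reflexive (++-identityʳ Γ))

⊥⇒empty : Derivable Γ (just ⊥̇) → Derivable Γ nothing
⊥⇒empty p = right-++-[] (cut-admissible ⊥̇ p (0 , ⊥L ↭-refl))

∧-fstᵈ : Derivable Γ (just (A ∧̇ B)) → Derivable Γ (just A)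
∧-fstᵈ {A = A} {B} p = right-++-[] (cut-admissible (A ∧̇ B) p (∧Lᵈ ↭-refl (axiom (here refl))))

∧-sndᵈ : Derivable Γ (just (A ∧̇ B)) → Derivable Γ (just B)
∧-sndᵈ {A = A} {B} p = right-++-[] (cut-admissible (A ∧̇ B) p (∧Lᵈ ↭-refl (axiom (there (here refl)))))

⊃-elimᵈ : Derivable [] (just (A ⊃ B)) → Derivable [ A ] (just B)
⊃-elimᵈ {A} p = mpᵈ (weakenL-++ʳᵈ [ A ] p) (axiom (here refl))

⇔⇒⟺ : Derivable [] (just (A ⇔̇ B)) → A ⟺ B
⇔⇒⟺ p = join raise raise (⊃-elimᵈ (∧-fstᵈ p)) (⊃-elimᵈ (∧-sndᵈ p))

complete : ⊢H φ → Derivable [] (just φ)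
complete (ax-K φ ψ) = ⊃Rᵈ (⊃Rᵈ (axiom (there (here refl))))
complete (ax-S φ ψ χ) =
  ⊃Rᵈ (⊃Rᵈ (⊃Rᵈ (mpᵈ (mpᵈ (axiom (there (there (here refl)))) (axiom (here refl)))
                     (mpᵈ (axiom (there (here refl))) (axiom (here refl))))))
complete (ax-∧E₁ φ ψ) = ⊃Rᵈ (∧Lᵈ ↭-refl (axiom (here refl)))
complete (ax-∧E₂ φ ψ) = ⊃Rᵈ (∧Lᵈ ↭-refl (axiom (there (here refl))))
complete (ax-∧I φ ψ) = ⊃Rᵈ (⊃Rᵈ (∧Rᵈ (axiom (there (here refl))) (axiom (here refl))))
complete (ax-∨I₁ φ ψ) = ⊃Rᵈ (∨R₁ᵈ (axiom (here refl)))
complete (ax-∨I₂ φ ψ) = ⊃Rᵈ (∨R₂ᵈ (axiom (here refl)))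
complete (ax-∨E φ ψ χ) =
  ⊃Rᵈ (⊃Rᵈ (⊃Rᵈ (∨Lᵈ ↭-refl (mpᵈ (axiom (there (there (here refl)))) (axiom (here refl)))
                             (mpᵈ (axiom (there (here refl))) (axiom (here refl))))))
complete (ax-EFQ φ) = ⊃Rᵈ (0 , ⊥L ↭-refl)
complete (mp p q) = mpᵈ (complete p) (complete q)
complete (CM□ φ ψ χ) =
  ⊃Rᵈ (∧Rᵈ (□Rᵈ {Γ₀ = []} [ (φ , ψ ∧̇ χ) ] ↭-refl (⟺-refl φ ∷ []) (∧Lᵈ ↭-refl (axiom (here refl))))
           (□Rᵈ {Γ₀ = []} [ (φ , ψ ∧̇ χ) ] ↭-refl (⟺-refl φ ∷ []) (∧Lᵈ ↭-refl (axiom (there (here refl))))))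
complete (CC□ φ ψ χ) =
  ⊃Rᵈ (∧Lᵈ ↭-refl (□Rᵈ {Γ₀ = []} ((φ , ψ) ∷ (φ , χ) ∷ []) ↭-refl (⟺-refl φ ∷ ⟺-refl φ ∷ [])
    (∧Rᵈ (axiom (here refl)) (axiom (there (here refl))))))
complete (CN□ φ) = □Rᵈ {Γ₀ = []} [] ↭-refl [] (⊃Rᵈ (0 , ⊥L ↭-refl))
complete (CN◇ φ) = ⊃Rᵈ (◇Rᵈ {Γ₀ = []} [] [] ↭-refl [] [] □◇cem-succedent (0 , ⊥L ↭-refl))
complete (CK◇ φ ψ χ) =
  ⊃Rᵈ (⊃Rᵈ (◇Rᵈ {Γ₀ = []} [ (φ , ψ ⊃ χ) ] [] swap-head (⟺-refl φ ∷ []) [] (◇cem-succedent (⟺-refl φ))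
    (mpᵈ (axiom (here refl)) (axiom (there (here refl))))))
complete (CEM◇ φ ψ χ) =
  ⊃Rᵈ (∧Lᵈ ↭-refl (◇Rᵈ {Γ₀ = []} [] [ (φ , ψ) ] ↭-refl [] (⟺-refl φ ∷ []) (◇cem-succedent (⟺-refl φ))
    (∧Rᵈ (axiom (here refl)) (axiom (there (here refl))))))
complete (RA□ ψ p) =
  ∧Rᵈ (⊃Rᵈ (□Rᵈ {Γ₀ = []} [ (_ , ψ) ] ↭-refl (⟺-sym (⇔⇒⟺ (complete p)) ∷ []) (identity ψ)))
      (⊃Rᵈ (□Rᵈ {Γ₀ = []} [ (_ , ψ) ] ↭-refl (⇔⇒⟺ (complete p) ∷ []) (identity ψ)))
complete (RC□ φ {ψ} {χ} p) =
  ∧Rᵈ (⊃Rᵈ (□Rᵈ {Γ₀ = []} [ (φ , ψ) ] ↭-refl (⟺-refl φ ∷ []) (⊃-elimᵈ (∧-fstᵈ (complete p)))))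
      (⊃Rᵈ (□Rᵈ {Γ₀ = []} [ (φ , χ) ] ↭-refl (⟺-refl φ ∷ []) (⊃-elimᵈ (∧-sndᵈ (complete p)))))
complete (RA◇ ψ p) =
  ∧Rᵈ (⊃Rᵈ (◇Rᵈ {Γ₀ = []} [] [] ↭-refl [] [] (◇cem-succedent (⇔⇒⟺ (complete p))) (identity ψ)))
      (⊃Rᵈ (◇Rᵈ {Γ₀ = []} [] [] ↭-refl [] [] (◇cem-succedent (⟺-sym (⇔⇒⟺ (complete p)))) (identity ψ)))
complete (RC◇ φ p) =
  ∧Rᵈ (⊃Rᵈ (◇Rᵈ {Γ₀ = []} [] [] ↭-refl [] [] (◇cem-succedent (⟺-refl φ)) (⊃-elimᵈ (∧-fstᵈ (complete p)))))
      (⊃Rᵈ (◇Rᵈ {Γ₀ = []} [] [] ↭-refl [] [] (◇cem-succedent (⟺-refl φ)) (⊃-elimᵈ (∧-sndᵈ (complete p)))))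

⋀-derivable : ∀ A Γ → Derivable (A ∷ Γ) (just (⋀ A Γ))
⋀-derivable A [] = identity A
⋀-derivable A (B ∷ Γ) = ∧Rᵈ (axiom (here refl)) (weakenLᵈ A (⋀-derivable B Γ))

ι-complete : ∀ Γ Δ → ⊢H (ι Γ Δ) → Derivable Γ (just (⋁ Δ))
ι-complete [] Δ p = complete p
ι-complete (A ∷ Γ) Δ p = mpᵈ (weakenL-++ʳᵈ (A ∷ Γ) (complete p)) (⋀-derivable A Γ)

⋁-succedent : ∀ Δ → Derivable Γ (just (⋁ Δ)) → Derivable Γ Δ
⋁-succedent nothing = ⊥⇒empty
⋁-succedent (just φ) d = d

theorem13 :
    (∀ {h Γ Δ} (φ : Fm) → D h Γ Δ → D h (φ ∷ Γ) Δ) ×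
    (∀ {h Γ} (φ : Fm) → D h Γ nothing → D h Γ (just φ)) ×
    (∀ {h Γ Δ} (φ : Fm) → D h (φ ∷ φ ∷ Γ) Δ → D h (φ ∷ Γ) Δ) ×
    (∀ {Γ Γ′ Δ} (φ : Fm) → Derivable Γ (just φ) → Derivable (φ ∷ Γ′) Δ →
      Derivable (Γ ++ Γ′) Δ) ×
    (∀ (Γ : List Fm) (Δ : Maybe Fm) → Derivable Γ Δ ⇔ ⊢H (ι Γ Δ))
theorem13 =
  weakenL , weakenR , contract , cut-admissible ,
  λ Γ Δ → mk⇔ (λ (_ , d) → ⊩⇒ι Γ Δ (sound d)) (λ ⊢ι → ⋁-succedent Δ (ι-complete Γ Δ ⊢ι))
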